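{- There exists $\eta_0\in(0,1)$ such that, for every $\eta\in(0,\eta_0)$, the following holds: if $G$ is a $K_4$-free graph of order $n$ and $k$ is an integer with $0\leq k\leq n$, then $$\mathrm{mis}_k(G)\leq (4-\eta)^{(5-\eta)k-n}(5-\eta)^{n-(4-\eta)k}.$$
   Context: All graphs are finite, simple and undirected. For a graph $G$ and a non-negative integer $k$, $\mathrm{mis}_k(G)$ denotes the number of maximal independent sets of $G$ (independent sets not properly contained in another independent set) that have exactly $k$ vertices. A graph is $K_4$-free if it contains no complete graph on $4$ vertices as a subgraph.
   Formalization: The parameter η ranges only over rational values in the interval $(0,\eta_0)$, and the threshold η₀ is taken rational. -}

module Defs where

open import Data.Bool using (Bool; true; false; _∧_; _∨_; not; if_then_else_)
open import Data.Nat as ℕ using (ℕ; zero; suc; _≡ᵇ_)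
open import Data.Integer as ℤ using (ℤ; +_; -[1+_])
open import Data.Fin using (Fin)
open import Data.Fin.Subset using (Subset; Side; inside; outside; ∣_∣)
open import Data.Vec using (Vec; []; _∷_; lookup)
open import Data.List using (List; []; _∷_; _++_; map; filterᵇ; length; allFin)
open import Data.Rational as ℚ using (ℚ; _/_; 1/_; _*_; ≢-nonZero)
open import Data.Rational.Properties using (_≟_)
open import Relation.Binary.PropositionalEquality using (_≡_)
open import Relation.Nullary using (yes; no)
open import Data.Empty using (⊥)

record Graph (n : ℕ) : Set where
  field
    adj    : Fin n → Fin n → Bool
    sym    : ∀ i j → adj i j ≡ adj j i
    irrefl : ∀ i → adj i i ≡ false
open Graph public

-- K4-free: no four vertices that are pairwise adjacent
-- (distinctness is automatic from irreflexivity).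
K4Free : ∀ {n} → Graph n → Set
K4Free {n} G = (a b c d : Fin n) →
  adj G a b ≡ true → adj G a c ≡ true → adj G a d ≡ true →
  adj G b c ≡ true → adj G b d ≡ true → adj G c d ≡ true → ⊥

isIn : Side → Bool
isIn inside  = true
isIn outside = false

_∈ᵇ_ : ∀ {n} → Fin n → Subset n → Bool
i ∈ᵇ S = isIn (lookup S i)

_⇒ᵇ_ : Bool → Bool → Bool
a ⇒ᵇ b = not a ∨ b

_==ᵇ_ : Bool → Bool → Bool
true  ==ᵇ b = b
false ==ᵇ b = not b

all : ∀ {A : Set} → (A → Bool) → List A → Bool
all p []       = true
all p (x ∷ xs) = p x ∧ all p xs

allSubsets : (n : ℕ) → List (Subset n)
allSubsets zero    = [] ∷ []
allSubsets (suc n) = map (outside ∷_) (allSubsets n) ++ map (inside ∷_) (allSubsets n)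

subsetᵇ : ∀ {n} → Subset n → Subset n → Bool
subsetᵇ {n} S T = all (λ i → (i ∈ᵇ S) ⇒ᵇ (i ∈ᵇ T)) (allFin n)

eqᵇ : ∀ {n} → Subset n → Subset n → Bool
eqᵇ {n} S T = all (λ i → (i ∈ᵇ S) ==ᵇ (i ∈ᵇ T)) (allFin n)

independentᵇ : ∀ {n} → Graph n → Subset n → Bool
independentᵇ {n} G S =
  all (λ i → all (λ j → ((i ∈ᵇ S) ∧ (j ∈ᵇ S)) ⇒ᵇ not (adj G i j)) (allFin n)) (allFin n)

maximalIndependentᵇ : ∀ {n} → Graph n → Subset n → Bool
maximalIndependentᵇ {n} G S =
  independentᵇ G S ∧
  all (λ T → (independentᵇ G T ∧ subsetᵇ S T) ⇒ᵇ eqᵇ S T) (allSubsets n)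

mis : ∀ {n} → ℕ → Graph n → ℕ
mis {n} k G =
  length (filterᵇ (λ S → maximalIndependentᵇ G S ∧ (∣ S ∣ ≡ᵇ k))
                 (allSubsets n))

ℕ→ℚ : ℕ → ℚ
ℕ→ℚ m = (+ m) / 1

_^ℕ_ : ℚ → ℕ → ℚ
x ^ℕ zero  = ℚ.1ℚ
x ^ℕ suc m = x * (x ^ℕ m)

-- multiplicative inverse (with the junk value 1/0 := 0; only used on nonzero bases)
inv : ℚ → ℚ
inv x with x ≟ ℚ.0ℚ
... | yes _ = ℚ.0ℚ
... | no x≢0 = 1/_ x {{≢-nonZero x≢0}}

_^ℤ_ : ℚ → ℤ → ℚ
x ^ℤ (+ m)     = x ^ℕ m
x ^ℤ -[1+ m ]  = inv (x ^ℕ suc m)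

-- The bound  m ≤ (4-η)^((5-η)k-n) · (5-η)^(n-(4-η)k)  for rational η = p/q
-- (p = ↥ η, q = ↧ₙ η > 0).  Both sides are positive, so it is equivalent to
-- its q-th power, in which all exponents are integers:
--   m^q ≤ (4-η)^((5q-p)k - nq) · (5-η)^(nq - (4q-p)k).
MisBound : ℚ → ℕ → ℕ → ℕ → Set
MisBound η n k m =
  (ℕ→ℚ m) ^ℕ q ℚ.≤
    ((ℕ→ℚ 4 ℚ.- η) ^ℤ (((+ 5) ℤ.* (+ q) ℤ.- p) ℤ.* (+ k) ℤ.- (+ n) ℤ.* (+ q)))
    ℚ.* ((ℕ→ℚ 5 ℚ.- η) ^ℤ ((+ n) ℤ.* (+ q) ℤ.- ((+ 4) ℤ.* (+ q) ℤ.- p) ℤ.* (+ k)))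
  where
    p : ℤ
    p = ℚ.↥ η
    q : ℕ
    q = ℚ.↧ₙ η

-- Write a = 4 - η and b = 5 - η.  For a vertex set U with N vertices, the maximal independent sets of
-- size k of G[U] number at most 5^k (b/a)^(N - 5k); this is proved by induction on N.  Take v of minimum
-- closed degree t in G[U].  Every such S of size k + 1 contains some w ∈ N[v], and S - w is a maximal
-- independent set of size k of G[U - N[w]], which has at most N - t vertices; so the bound propagates
-- as soon as t (b/a)^(5 - t) ≤ 5, which holds for all t ≠ 4 when η ≤ 1/2.  If t = 4, then N[v] is not
-- a clique because G is K4-free; branching on non-adjacent x, y ∈ N[v] (either S meets N[v] outside y,
-- or y ∈ S and x ∉ S) leaves three subproblems on N - 4 vertices and one on N - 5, and 3b/a + 1 ≤ 5.
-- Finally 5 a^η ≤ b^(1 + η) is weighted AM-GM (b is the mean of 5 and a with weights 1 and η), and it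
-- turns 5^k (b/a)^(n - 5k) into the stated bound.  For η = p/q all of this is done over ℕ after raising
-- to the q-th power, with α = q a = 4q - p and β = q b = 5q - p.

module Submission where

open import Defs hiding (sym)
open import Data.Nat using (ℕ; _≤_)
open import Data.Rational using (ℚ; 0ℚ; 1ℚ; _<_)
open import Data.Product using (Σ; _×_; _,_)

module _ where
  import Algebra.Properties.CommutativeMonoid.Sum as Sum
  open import Data.Bool using (Bool; true; false; _∧_; _∨_; not)
  open import Data.Bool.ListAction using (any)
  open import Data.Bool.Properties using (¬-not; not-¬; ∧-zeroʳ; ∨-conicalʳ; T-≡)
  open import Data.Empty using (⊥-elim)
  open import Data.Fin using (Fin; zero; suc)
  open import Data.Fin.Properties using (_≟_)
  open import Data.Fin.Subset using (Subset; inside; outside; ∣_∣)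
  open import Data.List using (List; []; _∷_; _++_; map; filterᵇ; length; allFin; tabulate)
  open import Data.List.Properties using (filter-++; length-++)
  open import Data.Nat
    using (zero; suc; _+_; _*_; _^_; _∸_; z≤n; s≤s; s≤s⁻¹; _≡ᵇ_; NonZero; >-nonZero; _≤′_; ≤′-refl; ≤′-step)
  open import Data.Nat.Properties renaming (_≟_ to _≟ℕ_)
  open import Data.Nat.Tactic.RingSolver using (solve-∀)
  open import Data.Product using (∃; proj₁; proj₂)
  open import Data.Sum using (_⊎_; inj₁; inj₂; [_,_]′)
  open import Data.Unit using (tt)
  open import Data.Vec using ([]; _∷_; _[_]≔_)
  open import Data.Vec.Properties using (lookup∘updateAt; lookup∘updateAt′)
  open import Function using (_∘_; _$_)
  open import Function.Bundles using (Equivalence)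
  open import Relation.Binary.PropositionalEquality
  open import Relation.Nullary using (¬_; Dec; does; yes; no; contradiction)
  open import Relation.Nullary.Decidable using (dec-true; dec-false; T?)

  open Sum +-0-commutativeMonoid using (sum; ∑-distrib-+; sum-cong-≗)
  open import Algebra.Properties.CommutativeSemigroup +-commutativeSemigroup
    using () renaming (interchange to +-interchange)
  open import Algebra.Properties.CommutativeSemigroup *-commutativeSemigroup using (x∙yz≈y∙xz)

  ∧-elimˡ : ∀ {a b} → a ∧ b ≡ true → a ≡ true
  ∧-elimˡ {true} _ = refl

  ∧-elimʳ : ∀ {a b} → a ∧ b ≡ true → b ≡ true
  ∧-elimʳ {true} b = b

  ∧-intro : ∀ {a b} → a ≡ true → b ≡ true → a ∧ b ≡ true
  ∧-intro refl b = b

  ∨-elim : ∀ {a b} → a ∨ b ≡ true → a ≡ true ⊎ b ≡ true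
  ∨-elim {true}  _ = inj₁ refl
  ∨-elim {false} b = inj₂ b

  ∨-introˡ : ∀ {a b} → a ≡ true → a ∨ b ≡ true
  ∨-introˡ refl = refl

  ∨-introʳ : ∀ {a b} → b ≡ true → a ∨ b ≡ true
  ∨-introʳ {true}  _ = refl
  ∨-introʳ {false} b = b

  not-true : ∀ {a} → not a ≡ true → a ≡ false
  not-true {false} _ = refl

  not-false : ∀ {a} → a ≡ false → not a ≡ true
  not-false refl = refl

  ⇒ᵇ-elim : ∀ {a b} → (a ⇒ᵇ b) ≡ true → a ≡ true → b ≡ true
  ⇒ᵇ-elim b refl = b

  ⇒ᵇ-intro : ∀ {a b} → (a ≡ true → b ≡ true) → (a ⇒ᵇ b) ≡ true
  ⇒ᵇ-intro {true}  f = f refl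
  ⇒ᵇ-intro {false} _ = refl

  does-sound : ∀ {A : Set} (a? : Dec A) → does a? ≡ true → A
  does-sound (yes a) _ = a

  all-tabulate⁻ : ∀ {A : Set} {n} (p : A → Bool) (f : Fin n → A) →
                  all p (tabulate f) ≡ true → ∀ i → p (f i) ≡ true
  all-tabulate⁻ p f h zero    = ∧-elimˡ h
  all-tabulate⁻ p f h (suc i) = all-tabulate⁻ p (f ∘ suc) (∧-elimʳ {p (f zero)} h) i

  all-tabulate⁺ : ∀ {A : Set} {n} (p : A → Bool) (f : Fin n → A) →
                  (∀ i → p (f i) ≡ true) → all p (tabulate f) ≡ true
  all-tabulate⁺ {n = zero}  p f h = refl
  all-tabulate⁺ {n = suc n} p f h = ∧-intro (h zero) (all-tabulate⁺ p (f ∘ suc) (h ∘ suc))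

  any-tabulate⁻ : ∀ {A : Set} {n} (p : A → Bool) (f : Fin n → A) →
                  any p (tabulate f) ≡ true → ∃ λ i → p (f i) ≡ true
  any-tabulate⁻ {n = suc n} p f h with ∨-elim {p (f zero)} h
  ... | inj₁ p₀ = zero , p₀
  ... | inj₂ ps = let i , pᵢ = any-tabulate⁻ p (f ∘ suc) ps in suc i , pᵢ

  any-tabulate⁺ : ∀ {A : Set} {n} (p : A → Bool) (f : Fin n → A) →
                  ∀ i → p (f i) ≡ true → any p (tabulate f) ≡ true
  any-tabulate⁺ p f zero    h = ∨-introˡ h
  any-tabulate⁺ p f (suc i) h = ∨-introʳ {p (f zero)} (any-tabulate⁺ p (f ∘ suc) i h)

  all-allFin⁻ : ∀ {n} (p : Fin n → Bool) → all p (allFin n) ≡ true → ∀ i → p i ≡ true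
  all-allFin⁻ p = all-tabulate⁻ p (λ i → i)

  all-allFin⁺ : ∀ {n} (p : Fin n → Bool) → (∀ i → p i ≡ true) → all p (allFin n) ≡ true
  all-allFin⁺ p = all-tabulate⁺ p (λ i → i)

  any-allFin⁻ : ∀ {n} (p : Fin n → Bool) → any p (allFin n) ≡ true → ∃ λ i → p i ≡ true
  any-allFin⁻ p = any-tabulate⁻ p (λ i → i)

  any-allFin⁺ : ∀ {n} (p : Fin n → Bool) → ∀ i → p i ≡ true → any p (allFin n) ≡ true
  any-allFin⁺ p = any-tabulate⁺ p (λ i → i)

  -- Cardinalities of vertex sets

  ⟦_⟧ : Bool → ℕ
  ⟦ true  ⟧ = 1
  ⟦ false ⟧ = 0

  ⟦⟧-mono : ∀ {a b} → (a ≡ true → b ≡ true) → ⟦ a ⟧ ≤ ⟦ b ⟧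
  ⟦⟧-mono {false} _ = z≤n
  ⟦⟧-mono {true}  h rewrite h refl = ≤-refl

  ⟦⟧-split : ∀ a b → ⟦ a ⟧ ≡ ⟦ a ∧ b ⟧ + ⟦ a ∧ not b ⟧
  ⟦⟧-split true  true  = refl
  ⟦⟧-split true  false = refl
  ⟦⟧-split false _     = refl

  sum-mono-≤ : ∀ {n} {f g : Fin n → ℕ} → (∀ i → f i ≤ g i) → sum f ≤ sum g
  sum-mono-≤ {zero}  _ = z≤n
  sum-mono-≤ {suc n} h = +-mono-≤ (h zero) (sum-mono-≤ (h ∘ suc))

  ≤-sum : ∀ {n} (f : Fin n → ℕ) i → f i ≤ sum f
  ≤-sum f zero    = m≤m+n (f zero) _
  ≤-sum f (suc i) = ≤-trans (≤-sum (f ∘ suc) i) (m≤n+m _ (f zero))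

  card : ∀ {n} → (Fin n → Bool) → ℕ
  card P = sum (λ i → ⟦ P i ⟧)

  infixl 6 _∩_ _∖_
  _∩_ _∖_ : ∀ {n} → (Fin n → Bool) → (Fin n → Bool) → Fin n → Bool
  (U ∩ V) i = U i ∧ V i
  (U ∖ V) i = U i ∧ not (V i)

  ⁅_⁆ᵇ : ∀ {n} → Fin n → Fin n → Bool
  ⁅ x ⁆ᵇ i = does (x ≟ i)

  card-mono : ∀ {n} {P Q : Fin n → Bool} → (∀ i → P i ≡ true → Q i ≡ true) → card P ≤ card Q
  card-mono h = sum-mono-≤ (λ i → ⟦⟧-mono (h i))

  card-∅ : ∀ {n} {P : Fin n → Bool} → (∀ i → P i ≡ false) → card P ≡ 0
  card-∅ {zero}  _ = refl
  card-∅ {suc n} h rewrite h zero = card-∅ (h ∘ suc)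

  card-⊤ : ∀ n → card {n} (λ _ → true) ≡ n
  card-⊤ zero    = refl
  card-⊤ (suc n) = cong suc (card-⊤ n)

  card-split : ∀ {n} (U V : Fin n → Bool) → card U ≡ card (U ∩ V) + card (U ∖ V)
  card-split {n} U V = trans (sum-cong-≗ {n} (λ i → ⟦⟧-split (U i) (V i)))
                             (∑-distrib-+ (λ i → ⟦ (U ∩ V) i ⟧) (λ i → ⟦ (U ∖ V) i ⟧))

  card-⁅⁆ : ∀ {n} (a : Fin n) → card ⁅ a ⁆ᵇ ≡ 1
  card-⁅⁆ {suc n} zero    = cong suc (card-∅ {n} {⁅ zero ⁆ᵇ ∘ suc} (λ _ → refl))
  card-⁅⁆ {suc n} (suc a) = card-⁅⁆ a

  card-∋ : ∀ {n} {P : Fin n → Bool} {x} → P x ≡ true → 1 ≤ card P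
  card-∋ {P = P} {x} Px = ≤-trans (≤-reflexive (cong ⟦_⟧ (sym Px))) (≤-sum (λ i → ⟦ P i ⟧) x)

  card-∩⁅⁆ : ∀ {n} {P : Fin n → Bool} {x} → P x ≡ true → card (P ∩ ⁅ x ⁆ᵇ) ≡ 1
  card-∩⁅⁆ {n} {P} {x} Px = trans (sum-cong-≗ {n} (cong ⟦_⟧ ∘ P∩x≡x)) (card-⁅⁆ x)
    where
    P∩x≡x : ∀ i → P i ∧ does (x ≟ i) ≡ does (x ≟ i)
    P∩x≡x i with x ≟ i
    ... | yes refl rewrite Px = refl
    ... | no _     = ∧-zeroʳ (P i)

  card-< : ∀ {n} {P Q : Fin n → Bool} → (∀ i → P i ≡ true → Q i ≡ true) →
           ∀ {x} → Q x ≡ true → P x ≡ false → suc (card P) ≤ card Q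
  card-< {n} {P} {Q} P⊆Q {x} Qx Px = begin
    suc (card P)                          ≤⟨ s≤s (card-mono {Q = Q ∖ ⁅ x ⁆ᵇ} P⊆Q∖x) ⟩
    suc (card (Q ∖ ⁅ x ⁆ᵇ))               ≡⟨ cong (_+ card (Q ∖ ⁅ x ⁆ᵇ)) (sym (card-∩⁅⁆ {n} {Q} Qx)) ⟩
    card (Q ∩ ⁅ x ⁆ᵇ) + card (Q ∖ ⁅ x ⁆ᵇ) ≡⟨ sym (card-split Q ⁅ x ⁆ᵇ) ⟩
    card Q                                ∎
    where
    open ≤-Reasoning
    P⊆Q∖x : ∀ i → P i ≡ true → (Q ∖ ⁅ x ⁆ᵇ) i ≡ true
    P⊆Q∖x i Pi with x ≟ i
    ... | yes refl = contradiction Px (not-¬ Pi)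
    ... | no _     = ∧-intro (P⊆Q i Pi) refl

  argmin : ∀ {n} (P : Fin n → Bool) (f : Fin n → ℕ) {x} → P x ≡ true →
           ∃ λ v → P v ≡ true × (∀ w → P w ≡ true → f v ≤ f w)
  argmin {n} P f {x} Px = go (suc (f x)) Px ≤-refl
    where
    go : ∀ b {x} → P x ≡ true → suc (f x) ≤ b → ∃ λ v → P v ≡ true × (∀ w → P w ≡ true → f v ≤ f w)
    go (suc b) {x} Px fx<b with any (λ w → P w ∧ does (f w <? f x)) (allFin n) in eq
    ... | false = x , Px , λ w Pw → ≮⇒≥ λ fw<fx →
                    not-¬ (any-allFin⁺ _ w (∧-intro Pw (dec-true (f w <? f x) fw<fx))) eq
    ... | true  = let w , h = any-allFin⁻ _ eq in
                  go b (∧-elimˡ h) (<-≤-trans (does-sound (f w <? f x) (∧-elimʳ {P w} h)) (s≤s⁻¹ fx<b))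

  card-nonempty : ∀ {n} {P : Fin n → Bool} → 1 ≤ card P → ∃ λ a → P a ≡ true
  card-nonempty {n} {P} h with any P (allFin n) in eq
  ... | true  = any-allFin⁻ P eq
  ... | false = contradiction (≤-trans h (≤-reflexive (card-∅ P≡∅))) 1+n≰n
    where
    P≡∅ : ∀ i → P i ≡ false
    P≡∅ i = ¬-not λ Pi → not-¬ (any-allFin⁺ P i Pi) eq

  card-extract : ∀ {n} {P : Fin n → Bool} m → suc m ≤ card P →
                 ∃ λ a → P a ≡ true × m ≤ card (P ∖ ⁅ a ⁆ᵇ)
  card-extract {P = P} m h with card-nonempty (≤-trans (s≤s z≤n) h)
  ... | a , Pa = a , Pa , ≤-pred (begin
    suc m                                 ≤⟨ h ⟩
    card P                                ≡⟨ card-split P ⁅ a ⁆ᵇ ⟩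
    card (P ∩ ⁅ a ⁆ᵇ) + card (P ∖ ⁅ a ⁆ᵇ) ≤⟨ +-monoˡ-≤ _ P∩a≤1 ⟩
    suc (card (P ∖ ⁅ a ⁆ᵇ))               ∎)
    where
    open ≤-Reasoning
    P∩a≤1 : card (P ∩ ⁅ a ⁆ᵇ) ≤ 1
    P∩a≤1 = ≤-trans (card-mono (λ i → ∧-elimʳ {P i})) (≤-reflexive (card-⁅⁆ a))

  ∖⁅⁆⁻ : ∀ {n} {P : Fin n → Bool} {a b} → (P ∖ ⁅ a ⁆ᵇ) b ≡ true → P b ≡ true × b ≢ a
  ∖⁅⁆⁻ {P = P} {a} {b} h = ∧-elimˡ h , λ { refl → not-¬ (dec-true (a ≟ a) refl) (not-true (∧-elimʳ {P b} h)) }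

  -- Counting subsets

  ∑ₛ : (n : ℕ) → (Subset n → ℕ) → ℕ
  ∑ₛ zero    f = f []
  ∑ₛ (suc n) f = ∑ₛ n (f ∘ (outside ∷_)) + ∑ₛ n (f ∘ (inside ∷_))

  ∑ₛ-mono-≤ : ∀ n {f g : Subset n → ℕ} → (∀ S → f S ≤ g S) → ∑ₛ n f ≤ ∑ₛ n g
  ∑ₛ-mono-≤ zero    h = h []
  ∑ₛ-mono-≤ (suc n) h = +-mono-≤ (∑ₛ-mono-≤ n (h ∘ (outside ∷_))) (∑ₛ-mono-≤ n (h ∘ (inside ∷_)))

  ∑ₛ-cong : ∀ n {f g : Subset n → ℕ} → (∀ S → f S ≡ g S) → ∑ₛ n f ≡ ∑ₛ n g
  ∑ₛ-cong n h = ≤-antisym (∑ₛ-mono-≤ n (≤-reflexive ∘ h)) (∑ₛ-mono-≤ n (≤-reflexive ∘ sym ∘ h))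

  ∑ₛ-distrib-+ : ∀ n (f g : Subset n → ℕ) → ∑ₛ n (λ S → f S + g S) ≡ ∑ₛ n f + ∑ₛ n g
  ∑ₛ-distrib-+ zero    f g = refl
  ∑ₛ-distrib-+ (suc n) f g = trans (cong₂ _+_ (∑ₛ-distrib-+ n _ _) (∑ₛ-distrib-+ n _ _))
                                   (+-interchange (∑ₛ n _) (∑ₛ n _) (∑ₛ n _) (∑ₛ n _))

  ∑ₛ-sum : ∀ n {m} (f : Fin m → Subset n → ℕ) → ∑ₛ n (λ S → sum (λ w → f w S)) ≡ sum (λ w → ∑ₛ n (f w))
  ∑ₛ-sum zero    f = refl
  ∑ₛ-sum (suc n) {m} f = trans (cong₂ _+_ (∑ₛ-sum n {m} _) (∑ₛ-sum n {m} _))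
                           (sym (∑-distrib-+ (λ w → ∑ₛ n (f w ∘ (outside ∷_))) (λ w → ∑ₛ n (f w ∘ (inside ∷_)))))

  count : (n : ℕ) → (Subset n → Bool) → ℕ
  count n P = ∑ₛ n (λ S → ⟦ P S ⟧)

  count-mono : ∀ n {P Q : Subset n → Bool} → (∀ S → P S ≡ true → Q S ≡ true) → count n P ≤ count n Q
  count-mono n h = ∑ₛ-mono-≤ n (λ S → ⟦⟧-mono (h S))

  count-∅ : ∀ n {P : Subset n → Bool} → (∀ S → P S ≡ false) → count n P ≡ 0
  count-∅ n {P} h = trans (∑ₛ-cong n (cong ⟦_⟧ ∘ h)) (∑ₛ-zero n)
    where
    ∑ₛ-zero : ∀ n → ∑ₛ n (λ _ → 0) ≡ 0
    ∑ₛ-zero zero    = refl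
    ∑ₛ-zero (suc n) = cong₂ _+_ (∑ₛ-zero n) (∑ₛ-zero n)

  count-split : ∀ n (P R : Subset n → Bool) →
                count n P ≡ count n (λ S → P S ∧ R S) + count n (λ S → P S ∧ not (R S))
  count-split n P R = trans (∑ₛ-cong n (λ S → ⟦⟧-split (P S) (R S))) (∑ₛ-distrib-+ n _ _)

  count-cover : ∀ n {m} {P : Subset n → Bool} {Q : Fin m → Subset n → Bool} →
                (∀ S → P S ≡ true → ∃ λ w → Q w S ≡ true) → count n P ≤ sum (λ w → count n (Q w))
  count-cover n {m} {P} {Q} cover =
    ≤-trans (∑ₛ-mono-≤ n ⟦P⟧≤∑⟦Q⟧) (≤-reflexive (∑ₛ-sum n {m} (λ w S → ⟦ Q w S ⟧)))
    where
    ⟦P⟧≤∑⟦Q⟧ : ∀ S → ⟦ P S ⟧ ≤ sum (λ w → ⟦ Q w S ⟧)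
    ⟦P⟧≤∑⟦Q⟧ S with P S in PS
    ... | false = z≤n
    ... | true  = let w , QwS = cover S PS in
                  ≤-trans (≤-reflexive (cong ⟦_⟧ (sym QwS))) (≤-sum (λ w → ⟦ Q w S ⟧) w)

  count-insert : ∀ n (u : Fin n) (P : Subset n → Bool) →
                 count n (λ S → u ∈ᵇ S ∧ P S) ≡ count n (λ S → not (u ∈ᵇ S) ∧ P (S [ u ]≔ inside))
  count-insert (suc n) zero    P = +-comm (count n (λ _ → false)) (count n (P ∘ (inside ∷_)))
  count-insert (suc n) (suc u) P =
    cong₂ _+_ (count-insert n u (P ∘ (outside ∷_))) (count-insert n u (P ∘ (inside ∷_)))

  count-empty : ∀ n → count n (λ S → ∣ S ∣ ≡ᵇ 0) ≡ 1
  count-empty zero    = refl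
  count-empty (suc n) = cong₂ _+_ (count-empty n) (count-∅ n (λ _ → refl))

  length-filterᵇ-map : ∀ {A B : Set} (P : B → Bool) (f : A → B) xs →
                       length (filterᵇ P (map f xs)) ≡ length (filterᵇ (P ∘ f) xs)
  length-filterᵇ-map P f []       = refl
  length-filterᵇ-map P f (x ∷ xs) with P (f x)
  ... | true  = cong suc (length-filterᵇ-map P f xs)
  ... | false = length-filterᵇ-map P f xs

  length-filterᵇ-allSubsets : ∀ n (P : Subset n → Bool) → length (filterᵇ P (allSubsets n)) ≡ count n P
  length-filterᵇ-allSubsets zero    P with P []
  ... | true  = refl
  ... | false = refl
  length-filterᵇ-allSubsets (suc n) P = begin
    length (filterᵇ P (map (outside ∷_) Ss ++ map (inside ∷_) Ss))
      ≡⟨ cong length (filter-++ (T? ∘ P) (map (outside ∷_) Ss) _) ⟩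
    length (filterᵇ P (map (outside ∷_) Ss) ++ filterᵇ P (map (inside ∷_) Ss))
      ≡⟨ length-++ (filterᵇ P (map (outside ∷_) Ss)) ⟩
    length (filterᵇ P (map (outside ∷_) Ss)) + length (filterᵇ P (map (inside ∷_) Ss))
      ≡⟨ cong₂ _+_ (trans (length-filterᵇ-map P _ Ss) (length-filterᵇ-allSubsets n _))
                   (trans (length-filterᵇ-map P _ Ss) (length-filterᵇ-allSubsets n _)) ⟩
    count (suc n) P ∎
    where
    open ≡-Reasoning
    Ss : List (Subset n)
    Ss = allSubsets n

  all-++⁻ : ∀ {A : Set} (p : A → Bool) xs {ys} → all p (xs ++ ys) ≡ true → all p xs ≡ true × all p ys ≡ true
  all-++⁻ p []       h = refl , h
  all-++⁻ p (x ∷ xs) h = let l , r = all-++⁻ p xs (∧-elimʳ {p x} h) in ∧-intro (∧-elimˡ h) l , r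

  all-map⁻ : ∀ {A B : Set} (p : B → Bool) (f : A → B) xs → all p (map f xs) ≡ true → all (p ∘ f) xs ≡ true
  all-map⁻ p f []       h = refl
  all-map⁻ p f (x ∷ xs) h = ∧-intro (∧-elimˡ h) (all-map⁻ p f xs (∧-elimʳ {p (f x)} h))

  all-allSubsets⁻ : ∀ n (p : Subset n → Bool) → all p (allSubsets n) ≡ true → ∀ T → p T ≡ true
  all-allSubsets⁻ zero    p h [] = ∧-elimˡ h
  all-allSubsets⁻ (suc n) p h T with all-++⁻ p (map (outside ∷_) (allSubsets n)) h
  all-allSubsets⁻ (suc n) p h (outside ∷ T) | hₒ , _ =
    all-allSubsets⁻ n (p ∘ (outside ∷_)) (all-map⁻ p (outside ∷_) (allSubsets n) hₒ) T
  all-allSubsets⁻ (suc n) p h (inside ∷ T)  | _ , hᵢ =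
    all-allSubsets⁻ n (p ∘ (inside ∷_)) (all-map⁻ p (inside ∷_) (allSubsets n) hᵢ) T

  ≡ᵇ-sound : ∀ {m k} → (m ≡ᵇ k) ≡ true → m ≡ k
  ≡ᵇ-sound {m} {k} h = ≡ᵇ⇒≡ m k (Equivalence.from T-≡ h)

  ≡ᵇ-complete : ∀ {m k} → m ≡ k → (m ≡ᵇ k) ≡ true
  ≡ᵇ-complete {m} {k} h = Equivalence.to T-≡ (≡⇒≡ᵇ m k h)

  ∣S∣≡suc⇒nonempty : ∀ {n k} (S : Subset n) → ∣ S ∣ ≡ suc k → ∃ λ i → i ∈ᵇ S ≡ true
  ∣S∣≡suc⇒nonempty (inside  ∷ S) _ = zero , refl
  ∣S∣≡suc⇒nonempty (outside ∷ S) h = let i , i∈S = ∣S∣≡suc⇒nonempty S h in suc i , i∈S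

  ∣S[u]≔inside∣ : ∀ {n} (S : Subset n) u → u ∈ᵇ S ≡ false → ∣ S [ u ]≔ inside ∣ ≡ suc ∣ S ∣
  ∣S[u]≔inside∣ (outside ∷ S) zero    _ = refl
  ∣S[u]≔inside∣ (outside ∷ S) (suc u) h = ∣S[u]≔inside∣ S u h
  ∣S[u]≔inside∣ (inside  ∷ S) (suc u) h = cong suc (∣S[u]≔inside∣ S u h)

  ∈ᵇ-[]≔-same : ∀ {n} (S : Subset n) u → u ∈ᵇ (S [ u ]≔ inside) ≡ true
  ∈ᵇ-[]≔-same S u = cong isIn (lookup∘updateAt u S)

  ∈ᵇ-[]≔-other : ∀ {n} (S : Subset n) {u i} → i ≢ u → i ∈ᵇ (S [ u ]≔ inside) ≡ i ∈ᵇ S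
  ∈ᵇ-[]≔-other S {u} {i} i≢u = cong isIn (lookup∘updateAt′ i u i≢u S)

  ∈ᵇ-[]≔⁺ : ∀ {n} (S : Subset n) u {i} → i ∈ᵇ S ≡ true → i ∈ᵇ (S [ u ]≔ inside) ≡ true
  ∈ᵇ-[]≔⁺ S u {i} i∈S with i ≟ u
  ... | yes refl = ∈ᵇ-[]≔-same S u
  ... | no i≢u   = trans (∈ᵇ-[]≔-other S i≢u) i∈S

  ∈ᵇ-[]≔⁻ : ∀ {n} (S : Subset n) u {i} → i ∈ᵇ (S [ u ]≔ inside) ≡ true → i ≡ u ⊎ i ∈ᵇ S ≡ true
  ∈ᵇ-[]≔⁻ S u {i} i∈T with i ≟ u
  ... | yes i≡u = inj₁ i≡u
  ... | no i≢u  = inj₂ (trans (sym (∈ᵇ-[]≔-other S i≢u)) i∈T)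

  module Induced {n : ℕ} (G : Graph n) where

    N[_] : Fin n → Fin n → Bool
    N[ v ] x = does (v ≟ x) ∨ adj G v x

    deg : (Fin n → Bool) → Fin n → ℕ
    deg U v = card (U ∩ N[ v ])

    v∈N[v] : ∀ v → N[ v ] v ≡ true
    v∈N[v] v = ∨-introˡ (dec-true (v ≟ v) refl)

    deg≤card : ∀ U v → deg U v ≤ card U
    deg≤card U v = card-mono (λ i → ∧-elimˡ {U i})

    card-∖N[] : ∀ U v → card (U ∖ N[ v ]) + deg U v ≡ card U
    card-∖N[] U v = trans (+-comm (card (U ∖ N[ v ])) (deg U v)) (sym (card-split U N[ v ]))

    _⊆ᵇ_ : Subset n → (Fin n → Bool) → Bool
    S ⊆ᵇ U = all (λ i → (i ∈ᵇ S) ⇒ᵇ U i) (allFin n)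

    dominatesᵇ : Subset n → (Fin n → Bool) → Bool
    dominatesᵇ S U = all (λ x → (U x ∧ not (x ∈ᵇ S)) ⇒ᵇ any (λ y → y ∈ᵇ S ∧ adj G x y) (allFin n)) (allFin n)

    misIn : (Fin n → Bool) → ℕ → Subset n → Bool
    misIn U k S = (S ⊆ᵇ U) ∧ independentᵇ G S ∧ dominatesᵇ S U ∧ (∣ S ∣ ≡ᵇ k)

    -- Maximality of S in the induced subgraph G[U] is expressed as domination of U ∖ S.
    record MaximalIndependentIn (U : Fin n → Bool) (k : ℕ) (S : Subset n) : Set where
      field
        ⊆U          : ∀ i → i ∈ᵇ S ≡ true → U i ≡ true
        independent : ∀ i j → i ∈ᵇ S ≡ true → j ∈ᵇ S ≡ true → adj G i j ≡ false
        dominating  : ∀ x → U x ≡ true → x ∈ᵇ S ≡ false → ∃ λ y → y ∈ᵇ S ≡ true × adj G x y ≡ true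
        size        : ∣ S ∣ ≡ k
    open MaximalIndependentIn

    independentᵇ-sound : ∀ {S} → independentᵇ G S ≡ true →
                         ∀ i j → i ∈ᵇ S ≡ true → j ∈ᵇ S ≡ true → adj G i j ≡ false
    independentᵇ-sound h i j i∈S j∈S =
      not-true (⇒ᵇ-elim (all-allFin⁻ _ (all-allFin⁻ _ h i) j) (∧-intro i∈S j∈S))

    independentᵇ-complete : ∀ {S} → (∀ i j → i ∈ᵇ S ≡ true → j ∈ᵇ S ≡ true → adj G i j ≡ false) →
                            independentᵇ G S ≡ true
    independentᵇ-complete {S} ind = all-allFin⁺ _ λ i → all-allFin⁺ _ λ j →
      ⇒ᵇ-intro λ both → not-false (ind i j (∧-elimˡ both) (∧-elimʳ {i ∈ᵇ S} both))

    misIn-sound : ∀ {U k S} → misIn U k S ≡ true → MaximalIndependentIn U k S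
    misIn-sound {U} {k} {S} h = record
      { ⊆U          = λ i → ⇒ᵇ-elim (all-allFin⁻ _ S⊆U i)
      ; independent = independentᵇ-sound {S} S-ind
      ; dominating  = dominating′
      ; size        = ≡ᵇ-sound S-size
      }
      where
      rest : (independentᵇ G S ∧ dominatesᵇ S U ∧ (∣ S ∣ ≡ᵇ k)) ≡ true
      rest = ∧-elimʳ {S ⊆ᵇ U} h
      S⊆U : (S ⊆ᵇ U) ≡ true
      S⊆U = ∧-elimˡ h
      S-ind : independentᵇ G S ≡ true
      S-ind = ∧-elimˡ rest
      S-dom : dominatesᵇ S U ≡ true
      S-dom = ∧-elimˡ (∧-elimʳ {independentᵇ G S} rest)
      S-size : (∣ S ∣ ≡ᵇ k) ≡ true
      S-size = ∧-elimʳ {dominatesᵇ S U} (∧-elimʳ {independentᵇ G S} rest)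
      dominating′ : ∀ x → U x ≡ true → x ∈ᵇ S ≡ false → ∃ λ y → y ∈ᵇ S ≡ true × adj G x y ≡ true
      dominating′ x Ux x∉S =
        let y , y∈S∧xy = any-allFin⁻ _ (⇒ᵇ-elim (all-allFin⁻ _ S-dom x) (∧-intro Ux (not-false x∉S)))
        in y , ∧-elimˡ y∈S∧xy , ∧-elimʳ {y ∈ᵇ S} y∈S∧xy

    misIn-complete : ∀ {U k S} → MaximalIndependentIn U k S → misIn U k S ≡ true
    misIn-complete {U} {k} {S} M =
      ∧-intro (all-allFin⁺ _ λ i → ⇒ᵇ-intro (⊆U M i))
      (∧-intro (independentᵇ-complete {S} (independent M))
      (∧-intro (all-allFin⁺ _ λ x → ⇒ᵇ-intro λ Ux∧x∉S →
                  let y , y∈S , xy = dominating M x (∧-elimˡ Ux∧x∉S) (not-true (∧-elimʳ {U x} Ux∧x∉S))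
                  in any-allFin⁺ _ y (∧-intro y∈S xy))
               (≡ᵇ-complete (size M))))

    ∉N[]⇒≢ : ∀ {u x} → N[ u ] x ≡ false → x ≢ u
    ∉N[]⇒≢ {u} x∉N refl = not-¬ (v∈N[v] u) x∉N

    ∉N[]⇒≁ : ∀ {u x} → N[ u ] x ≡ false → adj G x u ≡ false
    ∉N[]⇒≁ {u} {x} x∉N = trans (Graph.sym G x u) (∨-conicalʳ (does (u ≟ x)) _ x∉N)

    maximal⇒dominating : ∀ {S} → maximalIndependentᵇ G S ≡ true →
                         ∀ x → x ∈ᵇ S ≡ false → ∃ λ y → y ∈ᵇ S ≡ true × adj G x y ≡ true
    maximal⇒dominating {S} h x x∉S with any (λ y → y ∈ᵇ S ∧ adj G x y) (allFin n) in eq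
    ... | true  = let y , p = any-allFin⁻ _ eq in y , ∧-elimˡ p , ∧-elimʳ {y ∈ᵇ S} p
    ... | false = ⊥-elim (S≢T (⇒ᵇ-elim (all-allSubsets⁻ n _ (∧-elimʳ {independentᵇ G S} h) T) (∧-intro T-ind S⊆T)))
      where
      T : Subset n
      T = S [ x ]≔ inside
      x≁S : ∀ y → y ∈ᵇ S ≡ true → adj G x y ≡ false
      x≁S y y∈S = ¬-not λ xy → not-¬ (any-allFin⁺ _ y (∧-intro y∈S xy)) eq
      adj-T : ∀ {i j} → i ≡ x ⊎ i ∈ᵇ S ≡ true → j ≡ x ⊎ j ∈ᵇ S ≡ true → adj G i j ≡ false
      adj-T (inj₁ refl) (inj₁ refl) = irrefl G x
      adj-T (inj₁ refl) (inj₂ j∈S)  = x≁S _ j∈S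
      adj-T (inj₂ i∈S)  (inj₁ refl) = trans (Graph.sym G _ x) (x≁S _ i∈S)
      adj-T (inj₂ i∈S)  (inj₂ j∈S)  = independentᵇ-sound {S} (∧-elimˡ h) _ _ i∈S j∈S
      T-ind : independentᵇ G T ≡ true
      T-ind = independentᵇ-complete {T} λ i j i∈T j∈T → adj-T (∈ᵇ-[]≔⁻ S x i∈T) (∈ᵇ-[]≔⁻ S x j∈T)
      S⊆T : subsetᵇ S T ≡ true
      S⊆T = all-allFin⁺ _ λ i → ⇒ᵇ-intro (∈ᵇ-[]≔⁺ S x {i})
      S≢T : eqᵇ S T ≢ true
      S≢T S≡T = not-¬ (all-allFin⁻ _ S≡T x) (cong₂ _==ᵇ_ x∉S (∈ᵇ-[]≔-same S x))

    mis≤count-misIn : ∀ k → mis k G ≤ count n (misIn (λ _ → true) k)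
    mis≤count-misIn k = ≤-trans (≤-reflexive (length-filterᵇ-allSubsets n _)) (count-mono n maximal⇒misIn)
      where
      maximal⇒misIn : ∀ S → (maximalIndependentᵇ G S ∧ (∣ S ∣ ≡ᵇ k)) ≡ true → misIn (λ _ → true) k S ≡ true
      maximal⇒misIn S h = misIn-complete {λ _ → true} {k} {S} record
        { ⊆U          = λ _ _ → refl
        ; independent = independentᵇ-sound {S} (∧-elimˡ (∧-elimˡ h))
        ; dominating  = λ x _ → maximal⇒dominating {S} (∧-elimˡ h) x
        ; size        = ≡ᵇ-sound (∧-elimʳ {maximalIndependentᵇ G S} h)
        }

    misIn-meets-N[] : ∀ {U k S v} → U v ≡ true → MaximalIndependentIn U k S →
                      ∃ λ w → (U ∩ N[ v ]) w ≡ true × w ∈ᵇ S ≡ true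
    misIn-meets-N[] {S = S} {v} Uv M with v ∈ᵇ S in v∈S
    ... | true  = v , ∧-intro Uv (v∈N[v] v) , v∈S
    ... | false = let y , y∈S , vy = dominating M v Uv v∈S in
                  y , ∧-intro (⊆U M y y∈S) (∨-introʳ {does (v ≟ y)} vy) , y∈S

    misIn-restrict : ∀ {U V k S} → (∀ i → V i ≡ true → U i ≡ true) → (∀ i → i ∈ᵇ S ≡ true → V i ≡ true) →
                     MaximalIndependentIn U k S → MaximalIndependentIn V k S
    misIn-restrict V⊆U S⊆V M = record
      { ⊆U          = S⊆V
      ; independent = independent M
      ; dominating  = λ x Vx → dominating M x (V⊆U x Vx)
      ; size        = size M
      }

    misIn-remove : ∀ {U k S u} → u ∈ᵇ S ≡ false → MaximalIndependentIn U (suc k) (S [ u ]≔ inside) →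
                   MaximalIndependentIn (U ∖ N[ u ]) k S
    misIn-remove {U} {k} {S} {u} u∉S M = record
      { ⊆U          = λ i i∈S → ∧-intro (⊆U M i (∈ᵇ-[]≔⁺ S u i∈S)) (not-false (S∩N[u]≡∅ i i∈S))
      ; independent = λ i j i∈S j∈S → independent M i j (∈ᵇ-[]≔⁺ S u i∈S) (∈ᵇ-[]≔⁺ S u j∈S)
      ; dominating  = dominating′
      ; size        = suc-injective (trans (sym (∣S[u]≔inside∣ S u u∉S)) (size M))
      }
      where
      S∩N[u]≡∅ : ∀ i → i ∈ᵇ S ≡ true → N[ u ] i ≡ false
      S∩N[u]≡∅ i i∈S with u ≟ i
      ... | yes refl = contradiction u∉S (not-¬ i∈S)
      ... | no _     = independent M u i (∈ᵇ-[]≔-same S u) (∈ᵇ-[]≔⁺ S u i∈S)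
      dominating′ : ∀ x → (U ∖ N[ u ]) x ≡ true → x ∈ᵇ S ≡ false → ∃ λ y → y ∈ᵇ S ≡ true × adj G x y ≡ true
      dominating′ x x∈U∖N x∉S =
        let x∉N = not-true (∧-elimʳ {U x} x∈U∖N)
            y , y∈T , xy = dominating M x (∧-elimˡ x∈U∖N) (trans (∈ᵇ-[]≔-other S (∉N[]⇒≢ x∉N)) x∉S)
            y≢u = λ y≡u → not-¬ xy (subst (λ z → adj G x z ≡ false) (sym y≡u) (∉N[]⇒≁ x∉N))
        in y , trans (sym (∈ᵇ-[]≔-other S y≢u)) y∈T , xy

    count-branch : ∀ {U k} u → count n (λ S → u ∈ᵇ S ∧ misIn U (suc k) S) ≤ count n (misIn (U ∖ N[ u ]) k)
    count-branch {U} {k} u = begin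
      count n (λ S → u ∈ᵇ S ∧ misIn U (suc k) S)                         ≡⟨ count-insert n u (misIn U (suc k)) ⟩
      count n (λ S → not (u ∈ᵇ S) ∧ misIn U (suc k) (S [ u ]≔ inside))  ≤⟨ count-mono n removed ⟩
      count n (misIn (U ∖ N[ u ]) k)                                    ∎
      where
      open ≤-Reasoning
      removed : ∀ S → (not (u ∈ᵇ S) ∧ misIn U (suc k) (S [ u ]≔ inside)) ≡ true → misIn (U ∖ N[ u ]) k S ≡ true
      removed S h = misIn-complete {U ∖ N[ u ]} {k} {S}
        (misIn-remove (not-true (∧-elimˡ h)) (misIn-sound {U} {suc k} {S [ u ]≔ inside} (∧-elimʳ {not (u ∈ᵇ S)} h)))

    K4Free⇒nonadjacent : K4Free G → ∀ W → 4 ≤ card W →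
                         ∃ λ x → ∃ λ y → W x ≡ true × W y ≡ true × y ≢ x × adj G x y ≡ false
    K4Free⇒nonadjacent K4 W 4≤W
      with any (λ x → any (λ y → W x ∧ W y ∧ not (does (x ≟ y)) ∧ not (adj G x y)) (allFin n)) (allFin n) in eq
    ... | true  =
      let x , p = any-allFin⁻ _ eq
          y , q = any-allFin⁻ _ p
          r = ∧-elimʳ {W x} q
          s = ∧-elimʳ {W y} r
      in x , y , ∧-elimˡ q , ∧-elimˡ r
       , (λ y≡x → not-¬ (dec-true (x ≟ y) (sym y≡x)) (not-true (∧-elimˡ s)))
       , not-true (∧-elimʳ {not (does (x ≟ y))} s)
    ... | false = contradiction K4 (no-K4 adjacent)
      where
      adjacent : ∀ {a b} → W a ≡ true → W b ≡ true → b ≢ a → adj G a b ≡ true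
      adjacent {a} {b} Wa Wb b≢a = ¬-not λ ab → not-¬
        (any-allFin⁺ _ a (any-allFin⁺ _ b
          (∧-intro Wa (∧-intro Wb (∧-intro (not-false (dec-false (a ≟ b) (b≢a ∘ sym))) (not-false ab))))))
        eq
      no-K4 : (∀ {a b} → W a ≡ true → W b ≡ true → b ≢ a → adj G a b ≡ true) → ¬ K4Free G
      no-K4 E K4
        with card-extract 3 4≤W
      ... | a , Wa , 3≤ with card-extract 2 3≤
      ... | b , Wb-a , 2≤ with card-extract 1 2≤
      ... | c , Wc-ab , 1≤ with card-extract 0 1≤
      ... | d , Wd-abc , _ =
        let Wb , b≢a = ∖⁅⁆⁻ {P = W} Wb-a
            Wc-a , c≢b = ∖⁅⁆⁻ {P = W ∖ ⁅ a ⁆ᵇ} Wc-ab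
            Wc , c≢a = ∖⁅⁆⁻ {P = W} Wc-a
            Wd-ab , d≢c = ∖⁅⁆⁻ {P = W ∖ ⁅ a ⁆ᵇ ∖ ⁅ b ⁆ᵇ} Wd-abc
            Wd-a , d≢b = ∖⁅⁆⁻ {P = W ∖ ⁅ a ⁆ᵇ} Wd-ab
            Wd , d≢a = ∖⁅⁆⁻ {P = W} Wd-a
        in K4 a b c d (E Wa Wb b≢a) (E Wa Wc c≢a) (E Wa Wd d≢a) (E Wb Wc c≢b) (E Wb Wd d≢b) (E Wc Wd d≢c)

  ^-distribʳ-* : ∀ x y j → (x * y) ^ j ≡ x ^ j * y ^ j
  ^-distribʳ-* x y zero    = refl
  ^-distribʳ-* x y (suc j) = trans (cong (x * y *_) (^-distribʳ-* x y j)) (shuffle x y (x ^ j) (y ^ j))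
    where
    shuffle : ∀ x y a b → x * y * (a * b) ≡ x * a * (y * b)
    shuffle = solve-∀

  module Recurrence (α β : ℕ) (1≤α : 1 ≤ α) (6α≤5β : 6 * α ≤ 5 * β) (7β≤9α : 7 * β ≤ 9 * α) where

    open ≤-Reasoning

    lhs rhs : ℕ → ℕ → ℕ
    lhs N k = β ^ (5 * k) * α ^ N
    rhs N k = 5 ^ k * β ^ N * α ^ (5 * k)

    -- m ≤ c · 5^k · (β/α)^(N - 5k), with denominators cleared.
    record Bounded (c N k m : ℕ) : Set where
      constructor bounded
      field
        bound : m * lhs N k ≤ c * rhs N k

    α≤β : α ≤ β
    α≤β = *-cancelˡ-≤ 5 (≤-trans (*-monoˡ-≤ α (n≤1+n 5)) 6α≤5β)

    3β≤4α : 3 * β ≤ 4 * α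
    3β≤4α = *-cancelˡ-≤ 7 (begin
      7 * (3 * β) ≡⟨ trans (sym (*-assoc 7 3 β)) (*-assoc 3 7 β) ⟩
      3 * (7 * β) ≤⟨ *-monoʳ-≤ 3 7β≤9α ⟩
      3 * (9 * α) ≡⟨ sym (*-assoc 3 9 α) ⟩
      27 * α      ≤⟨ *-monoˡ-≤ α (n≤1+n 27) ⟩
      28 * α      ≡⟨ *-assoc 7 4 α ⟩
      7 * (4 * α) ∎)

    ^-5*suc : ∀ x k → x ^ (5 * suc k) ≡ x ^ 5 * x ^ (5 * k)
    ^-5*suc x k = trans (cong (x ^_) (*-suc 5 k)) (^-distribˡ-+-* x 5 (5 * k))

    lhs-suc : ∀ N k → lhs (suc N) k ≡ lhs N k * α
    lhs-suc N k = reorder (β ^ (5 * k)) α (α ^ N)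
      where
      reorder : ∀ b a x → b * (a * x) ≡ b * x * a
      reorder = solve-∀

    rhs-suc : ∀ N k → rhs (suc N) k ≡ rhs N k * β
    rhs-suc N k = reorder (5 ^ k) β (β ^ N) (α ^ (5 * k))
      where
      reorder : ∀ f b x a → f * (b * x) * a ≡ f * x * a * b
      reorder = solve-∀

    lhs-split : ∀ s t k → lhs (s + t) (suc k) ≡ lhs s k * (β ^ 5 * α ^ t)
    lhs-split s t k = begin-equality
      β ^ (5 * suc k) * α ^ (s + t)          ≡⟨ cong₂ _*_ (^-5*suc β k) (^-distribˡ-+-* α s t) ⟩
      β ^ 5 * β ^ (5 * k) * (α ^ s * α ^ t)  ≡⟨ reorder (β ^ 5) (β ^ (5 * k)) (α ^ s) (α ^ t) ⟩
      β ^ (5 * k) * α ^ s * (β ^ 5 * α ^ t)  ∎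
      where
      reorder : ∀ b₅ bₖ aₛ aₜ → b₅ * bₖ * (aₛ * aₜ) ≡ bₖ * aₛ * (b₅ * aₜ)
      reorder = solve-∀

    rhs-split : ∀ s t k → rhs (s + t) (suc k) ≡ rhs s k * (5 * β ^ t * α ^ 5)
    rhs-split s t k = begin-equality
      5 * 5 ^ k * β ^ (s + t) * α ^ (5 * suc k)                ≡⟨ cong₂ (λ x y → 5 * 5 ^ k * x * y)
                                                                     (^-distribˡ-+-* β s t) (^-5*suc α k) ⟩
      5 * 5 ^ k * (β ^ s * β ^ t) * (α ^ 5 * α ^ (5 * k))      ≡⟨ reorder (5 ^ k) (β ^ s) (β ^ t) (α ^ 5) (α ^ (5 * k)) ⟩
      5 ^ k * β ^ s * α ^ (5 * k) * (5 * β ^ t * α ^ 5)        ∎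
      where
      reorder : ∀ f bₛ bₜ a₅ aₖ → 5 * f * (bₛ * bₜ) * (a₅ * aₖ) ≡ f * bₛ * aₖ * (5 * bₜ * a₅)
      reorder = solve-∀

    few : ∀ t j → t * 9 ^ j ≤ 5 * 7 ^ j → t * β ^ j ≤ 5 * α ^ j
    few t j h = *-cancelˡ-≤ (7 ^ j) {{m^n≢0 7 j}} (begin
      7 ^ j * (t * β ^ j)   ≡⟨ x∙yz≈y∙xz (7 ^ j) t (β ^ j) ⟩
      t * (7 ^ j * β ^ j)   ≡⟨ cong (t *_) (sym (^-distribʳ-* 7 β j)) ⟩
      t * (7 * β) ^ j       ≤⟨ *-monoʳ-≤ t (^-monoˡ-≤ j 7β≤9α) ⟩
      t * (9 * α) ^ j       ≡⟨ trans (cong (t *_) (^-distribʳ-* 9 α j)) (sym (*-assoc t (9 ^ j) (α ^ j))) ⟩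
      t * 9 ^ j * α ^ j     ≤⟨ *-monoˡ-≤ (α ^ j) h ⟩
      5 * 7 ^ j * α ^ j     ≡⟨ trans (cong (_* α ^ j) (*-comm 5 (7 ^ j))) (*-assoc (7 ^ j) 5 (α ^ j)) ⟩
      7 ^ j * (5 * α ^ j)   ∎)

    many : ∀ j → (5 + j) * α ^ j ≤ 5 * β ^ j
    many zero    = ≤-refl
    many (suc j) = begin
      (6 + j) * (α * α ^ j) ≡⟨ sym (*-assoc (6 + j) α (α ^ j)) ⟩
      (6 + j) * α * α ^ j   ≤⟨ *-monoˡ-≤ (α ^ j) [6+j]α≤[5+j]β ⟩
      (5 + j) * β * α ^ j   ≡⟨ trans (cong (_* α ^ j) (*-comm (5 + j) β)) (*-assoc β (5 + j) (α ^ j)) ⟩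
      β * ((5 + j) * α ^ j) ≤⟨ *-monoʳ-≤ β (many j) ⟩
      β * (5 * β ^ j)       ≡⟨ x∙yz≈y∙xz β 5 (β ^ j) ⟩
      5 * (β * β ^ j)       ∎
      where
      [6+j]α≤[5+j]β : (6 + j) * α ≤ (5 + j) * β
      [6+j]α≤[5+j]β = begin
        (6 + j) * α     ≡⟨ *-distribʳ-+ α 6 j ⟩
        6 * α + j * α   ≤⟨ +-mono-≤ 6α≤5β (*-monoʳ-≤ j α≤β) ⟩
        5 * β + j * β   ≡⟨ sym (*-distribʳ-+ β 5 j) ⟩
        (5 + j) * β     ∎

    key-below : ∀ t j → t * β ^ j ≤ 5 * α ^ j → t * β ^ (t + j) * α ^ t ≤ 5 * β ^ t * α ^ (t + j)
    key-below t j h = begin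
      t * β ^ (t + j) * α ^ t         ≡⟨ cong (λ x → t * x * α ^ t) (^-distribˡ-+-* β t j) ⟩
      t * (β ^ t * β ^ j) * α ^ t     ≡⟨ reorder t (β ^ t) (β ^ j) (α ^ t) ⟩
      β ^ t * α ^ t * (t * β ^ j)     ≤⟨ *-monoʳ-≤ (β ^ t * α ^ t) h ⟩
      β ^ t * α ^ t * (5 * α ^ j)     ≡⟨ reorder′ (β ^ t) (α ^ t) (α ^ j) ⟩
      5 * β ^ t * (α ^ t * α ^ j)     ≡⟨ cong (5 * β ^ t *_) (sym (^-distribˡ-+-* α t j)) ⟩
      5 * β ^ t * α ^ (t + j)         ∎
      where
      reorder : ∀ t bₜ bⱼ aₜ → t * (bₜ * bⱼ) * aₜ ≡ bₜ * aₜ * (t * bⱼ)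
      reorder = solve-∀
      reorder′ : ∀ bₜ aₜ aⱼ → bₜ * aₜ * (5 * aⱼ) ≡ 5 * bₜ * (aₜ * aⱼ)
      reorder′ = solve-∀

    key-above : ∀ j → (5 + j) * α ^ j ≤ 5 * β ^ j → (5 + j) * β ^ 5 * α ^ (5 + j) ≤ 5 * β ^ (5 + j) * α ^ 5
    key-above j h = begin
      (5 + j) * β ^ 5 * α ^ (5 + j)        ≡⟨ cong ((5 + j) * β ^ 5 *_) (^-distribˡ-+-* α 5 j) ⟩
      (5 + j) * β ^ 5 * (α ^ 5 * α ^ j)    ≡⟨ reorder (5 + j) (β ^ 5) (α ^ 5) (α ^ j) ⟩
      β ^ 5 * α ^ 5 * ((5 + j) * α ^ j)    ≤⟨ *-monoʳ-≤ (β ^ 5 * α ^ 5) h ⟩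
      β ^ 5 * α ^ 5 * (5 * β ^ j)          ≡⟨ reorder′ (β ^ 5) (α ^ 5) (β ^ j) ⟩
      5 * (β ^ 5 * β ^ j) * α ^ 5          ≡⟨ cong (λ x → 5 * x * α ^ 5) (sym (^-distribˡ-+-* β 5 j)) ⟩
      5 * β ^ (5 + j) * α ^ 5              ∎
      where
      reorder : ∀ t b₅ a₅ aⱼ → t * b₅ * (a₅ * aⱼ) ≡ b₅ * a₅ * (t * aⱼ)
      reorder = solve-∀
      reorder′ : ∀ b₅ a₅ bⱼ → b₅ * a₅ * (5 * bⱼ) ≡ 5 * (b₅ * bⱼ) * a₅
      reorder′ = solve-∀

    -- t (β/α)^(5 - t) ≤ 5: for t ≤ 3 because β/α ≤ 9/7, for t ≥ 5 because β/α ≥ 6/5;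
    -- t = 4 would need β/α ≤ 5/4.
    key : ∀ t → t ≢ 4 → t * β ^ 5 * α ^ t ≤ 5 * β ^ t * α ^ 5
    key 0 _   = z≤n
    key 1 _   = key-below 1 4 (few 1 4 (≤ᵇ⇒≤ _ _ tt))
    key 2 _   = key-below 2 3 (few 2 3 (≤ᵇ⇒≤ _ _ tt))
    key 3 _   = key-below 3 2 (few 3 2 (≤ᵇ⇒≤ _ _ tt))
    key 4 4≢4 = contradiction refl 4≢4
    key (suc (suc (suc (suc (suc j))))) _ = key-above j (many j)

    bounded-mono-m : ∀ {c N k m m′} → m ≤ m′ → Bounded c N k m′ → Bounded c N k m
    bounded-mono-m {N = N} {k} m≤m′ (bounded h) = bounded (≤-trans (*-monoˡ-≤ (lhs N k) m≤m′) h)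

    bounded-suc : ∀ {c N k m} → Bounded c N k m → Bounded c (suc N) k m
    bounded-suc {c} {N} {k} {m} (bounded h) = bounded $ begin
      m * lhs (suc N) k    ≡⟨ trans (cong (m *_) (lhs-suc N k)) (sym (*-assoc m (lhs N k) α)) ⟩
      m * lhs N k * α      ≤⟨ *-mono-≤ h α≤β ⟩
      c * rhs N k * β      ≡⟨ trans (*-assoc c (rhs N k) β) (cong (c *_) (sym (rhs-suc N k))) ⟩
      c * rhs (suc N) k    ∎

    bounded-mono-N : ∀ {c N N′ k m} → N ≤ N′ → Bounded c N k m → Bounded c N′ k m
    bounded-mono-N {c} {N} {N′} {k} {m} N≤N′ h = go (≤⇒≤′ N≤N′)
      where
      go : ∀ {N′} → N ≤′ N′ → Bounded c N′ k m
      go ≤′-refl         = h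
      go (≤′-step {N″} N≤′N″) = bounded-suc {c} {N″} {k} {m} (go N≤′N″)

    bounded-≤1 : ∀ {N m} → m ≤ 1 → Bounded 1 N 0 m
    bounded-≤1 {N} {m} m≤1 = bounded $ begin
      m * (1 * α ^ N)      ≤⟨ *-mono-≤ m≤1 (≤-reflexive (*-identityˡ (α ^ N))) ⟩
      1 * α ^ N            ≤⟨ *-monoʳ-≤ 1 (^-monoˡ-≤ N α≤β) ⟩
      1 * β ^ N            ≡⟨ cong (1 *_) (sym (trans (*-identityʳ (1 * β ^ N)) (*-identityˡ (β ^ N)))) ⟩
      1 * (1 * β ^ N * 1)  ∎

    bounded-sum : ∀ {n N k} (W : Fin n → Bool) (f : Fin n → ℕ) →
                  (∀ w → W w ≡ true → Bounded 1 N k (f w)) → (∀ w → W w ≡ false → f w ≡ 0) →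
                  Bounded (card W) N k (sum f)
    bounded-sum {zero}          W f _  _  = bounded z≤n
    bounded-sum {suc n} {N} {k} W f h₁ h₀ = bounded $ begin
      (f zero + sum (f ∘ suc)) * X               ≡⟨ *-distribʳ-+ X (f zero) (sum (f ∘ suc)) ⟩
      f zero * X + sum (f ∘ suc) * X             ≤⟨ +-mono-≤ head tail ⟩
      ⟦ W zero ⟧ * Y + card (W ∘ suc) * Y        ≡⟨ sym (*-distribʳ-+ Y ⟦ W zero ⟧ (card (W ∘ suc))) ⟩
      (⟦ W zero ⟧ + card (W ∘ suc)) * Y          ∎
      where
      X Y : ℕ
      X = lhs N k
      Y = rhs N k
      tail : sum (f ∘ suc) * X ≤ card (W ∘ suc) * Y
      tail = Bounded.bound (bounded-sum (W ∘ suc) (f ∘ suc) (h₁ ∘ suc) (h₀ ∘ suc))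
      head : f zero * X ≤ ⟦ W zero ⟧ * Y
      head with W zero in W₀
      ... | true  = Bounded.bound (h₁ zero W₀)
      ... | false = ≤-reflexive (cong (_* X) (h₀ zero W₀))

    bounded-step : ∀ {t s k m} → t ≢ 4 → Bounded t s k m → Bounded 1 (s + t) (suc k) m
    bounded-step {t} {s} {k} {m} t≢4 (bounded h) = bounded $ begin
      m * lhs (s + t) (suc k)           ≡⟨ trans (cong (m *_) (lhs-split s t k)) (sym (*-assoc m (lhs s k) _)) ⟩
      m * lhs s k * (β ^ 5 * α ^ t)     ≤⟨ *-monoˡ-≤ (β ^ 5 * α ^ t) h ⟩
      t * rhs s k * (β ^ 5 * α ^ t)     ≡⟨ reorder t (rhs s k) (β ^ 5) (α ^ t) ⟩
      rhs s k * (t * β ^ 5 * α ^ t)     ≤⟨ *-monoʳ-≤ (rhs s k) (key t t≢4) ⟩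
      rhs s k * (5 * β ^ t * α ^ 5)     ≡⟨ trans (sym (rhs-split s t k)) (sym (*-identityˡ _)) ⟩
      1 * rhs (s + t) (suc k)           ∎
      where
      reorder : ∀ t r b a → t * r * (b * a) ≡ r * (t * b * a)
      reorder = solve-∀

    -- 3 (β/α)^(N-4) + (β/α)^(N-5) ≤ 5 (β/α)^(N-5) because 3β ≤ 4α.
    bounded-step-4 : ∀ {s k mA mB} → Bounded 3 (suc s) k mA → Bounded 1 s k mB →
                     Bounded 1 (s + 5) (suc k) (mA + mB)
    bounded-step-4 {s} {k} {mA} {mB} (bounded hA) (bounded hB) = bounded $ begin
      (mA + mB) * lhs (s + 5) (suc k)   ≡⟨ trans (cong ((mA + mB) *_) (lhs-split s 5 k)) (sym (*-assoc (mA + mB) L _)) ⟩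
      (mA + mB) * L * (β ^ 5 * α ^ 5)   ≤⟨ *-monoˡ-≤ (β ^ 5 * α ^ 5) core ⟩
      5 * R * (β ^ 5 * α ^ 5)                   ≡⟨ reorder R (β ^ 5) (α ^ 5) ⟩
      R * (5 * β ^ 5 * α ^ 5)                   ≡⟨ trans (sym (rhs-split s 5 k)) (sym (*-identityˡ _)) ⟩
      1 * rhs (s + 5) (suc k)                   ∎
      where
      L R : ℕ
      L = lhs s k
      R = rhs s k
      reorder : ∀ r b a → 5 * r * (b * a) ≡ r * (5 * b * a)
      reorder = solve-∀
      distrib : ∀ a b l x → (a + b) * l * x ≡ a * (l * x) + b * l * x
      distrib = solve-∀
      regroup : ∀ r b a → 3 * (r * b) + 1 * r * a ≡ r * (3 * b) + r * a
      regroup = solve-∀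
      collect : ∀ r a → r * (4 * a) + r * a ≡ 5 * r * a
      collect = solve-∀
      cancelled : (mA + mB) * L * α ≤ 5 * R * α
      cancelled = begin
        (mA + mB) * L * α                  ≡⟨ trans (distrib mA mB L α)
                                                    (cong (λ x → mA * x + mB * L * α) (sym (lhs-suc s k))) ⟩
        mA * lhs (suc s) k + mB * L * α    ≤⟨ +-mono-≤ hA (*-monoˡ-≤ α hB) ⟩
        3 * rhs (suc s) k + 1 * R * α      ≡⟨ trans (cong (λ x → 3 * x + 1 * R * α) (rhs-suc s k)) (regroup R β α) ⟩
        R * (3 * β) + R * α                ≤⟨ +-monoˡ-≤ (R * α) (*-monoʳ-≤ R 3β≤4α) ⟩
        R * (4 * α) + R * α                ≡⟨ collect R α ⟩
        5 * R * α                          ∎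
      core : (mA + mB) * L ≤ 5 * R
      core = *-cancelʳ-≤ ((mA + mB) * L) (5 * R) α {{>-nonZero 1≤α}} cancelled

  module K4FreeBound {n : ℕ} (G : Graph n) (K4 : K4Free G)
                     (α β : ℕ) (1≤α : 1 ≤ α) (6α≤5β : 6 * α ≤ 5 * β) (7β≤9α : 7 * β ≤ 9 * α) where

    open Induced G
    open MaximalIndependentIn
    open Recurrence α β 1≤α 6α≤5β 7β≤9α
    open ≤-Reasoning

    BoundedIn : (Fin n → Bool) → Set
    BoundedIn U = ∀ k → Bounded 1 (card U) k (count n (misIn U k))

    BoundedBelow : (Fin n → Bool) → Set
    BoundedBelow U = ∀ U′ → suc (card U′) ≤ card U → BoundedIn U′

    bounded-branch : ∀ {U s k} → BoundedBelow U → ∀ w → U w ≡ true → card U ≤ s + deg U w →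
                     Bounded 1 s k (count n (λ S → w ∈ᵇ S ∧ misIn U (suc k) S))
    bounded-branch {U} {s} {k} ih w Uw card≤ =
      bounded-mono-m (count-branch w) (bounded-mono-N card≤s (ih (U ∖ N[ w ]) smaller k))
      where
      smaller : suc (card (U ∖ N[ w ])) ≤ card U
      smaller = begin
        suc (card (U ∖ N[ w ]))       ≡⟨ +-comm 1 _ ⟩
        card (U ∖ N[ w ]) + 1         ≤⟨ +-monoʳ-≤ _ (card-∋ {n} {U ∩ N[ w ]} (∧-intro Uw (v∈N[v] w))) ⟩
        card (U ∖ N[ w ]) + deg U w   ≡⟨ card-∖N[] U w ⟩
        card U                        ∎
      card≤s : card (U ∖ N[ w ]) ≤ s
      card≤s = +-cancelʳ-≤ (deg U w) _ _ (≤-trans (≤-reflexive (card-∖N[] U w)) card≤)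

    bounded-∑branch : ∀ {U s k} → BoundedBelow U → (W : Fin n → Bool) →
                      (∀ w → W w ≡ true → U w ≡ true × card U ≤ s + deg U w) →
                      Bounded (card W) s k (sum (λ w → count n (λ S → W w ∧ (w ∈ᵇ S ∧ misIn U (suc k) S))))
    bounded-∑branch {U} {s} {k} ih W W-ok = bounded-sum W _ branch vanish
      where
      branch : ∀ w → W w ≡ true → Bounded 1 s k (count n (λ S → W w ∧ (w ∈ᵇ S ∧ misIn U (suc k) S)))
      branch w Ww = let Uw , card≤ = W-ok w Ww in
        bounded-mono-m (count-mono n (λ S → ∧-elimʳ {W w})) (bounded-branch ih w Uw card≤)
      vanish : ∀ w → W w ≡ false → count n (λ S → W w ∧ (w ∈ᵇ S ∧ misIn U (suc k) S)) ≡ 0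
      vanish w Ww = count-∅ n (λ S → cong (_∧ (w ∈ᵇ S ∧ misIn U (suc k) S)) Ww)

    bounded-deg≢4 : ∀ {U v k} → BoundedBelow U → U v ≡ true → (∀ w → U w ≡ true → deg U v ≤ deg U w) →
                    deg U v ≢ 4 → Bounded 1 (card U) (suc k) (count n (misIn U (suc k)))
    bounded-deg≢4 {U} {v} {k} ih Uv minimal t≢4 =
      subst (λ N → Bounded 1 N (suc k) (count n (misIn U (suc k)))) s+t≡card
        (bounded-step t≢4 (bounded-mono-m covered (bounded-∑branch ih (U ∩ N[ v ]) W-ok)))
      where
      s : ℕ
      s = card U ∸ deg U v
      s+t≡card : s + deg U v ≡ card U
      s+t≡card = m∸n+n≡m (deg≤card U v)
      W-ok : ∀ w → (U ∩ N[ v ]) w ≡ true → U w ≡ true × card U ≤ s + deg U w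
      W-ok w Ww = let Uw = ∧-elimˡ Ww in Uw , ≤-trans (≤-reflexive (sym s+t≡card)) (+-monoʳ-≤ s (minimal w Uw))
      covered : count n (misIn U (suc k)) ≤
                sum (λ w → count n (λ S → (U ∩ N[ v ]) w ∧ (w ∈ᵇ S ∧ misIn U (suc k) S)))
      covered = count-cover n λ S S∈F →
        let w , Ww , w∈S = misIn-meets-N[] Uv (misIn-sound {U} {suc k} {S} S∈F) in
        w , ∧-intro Ww (∧-intro w∈S S∈F)

    -- N[v] ∩ U has four vertices but is not a clique; with x, y ∈ N[v] ∩ U non-adjacent, every S
    -- either meets N[v] ∩ U outside y, or contains y but not x and then avoids N[y] ∪ {x}.
    module Degree4 {U : Fin n → Bool} {v : Fin n} {k : ℕ} (ih : BoundedBelow U) (Uv : U v ≡ true)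
                   (minimal : ∀ w → U w ≡ true → deg U v ≤ deg U w) (deg≡4 : deg U v ≡ 4)
                   {x y : Fin n} (Wx : (U ∩ N[ v ]) x ≡ true) (Wy : (U ∩ N[ v ]) y ≡ true)
                   (y≢x : y ≢ x) (x≁y : adj G x y ≡ false) where

      W : Fin n → Bool
      W = U ∩ N[ v ]

      P : Subset n → Bool
      P = misIn U (suc k)

      s : ℕ
      s = card U ∸ 5

      R : Subset n → Bool
      R S = y ∈ᵇ S ∧ not (x ∈ᵇ S)

      4≤deg : ∀ w → U w ≡ true → 4 ≤ deg U w
      4≤deg w Uw = subst (_≤ deg U w) deg≡4 (minimal w Uw)

      x∈U∖N[y] : (U ∖ N[ y ]) x ≡ true
      x∈U∖N[y] = ∧-intro (∧-elimˡ Wx) (not-false x∉N[y])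
        where
        x∉N[y] : N[ y ] x ≡ false
        x∉N[y] with y ≟ x
        ... | yes y≡x = contradiction y≡x y≢x
        ... | no _    = trans (Graph.sym G y x) x≁y

      card≡ : card U ≡ suc s + 4
      card≡ = trans (sym (m∸n+n≡m 5≤card)) (+-suc s 4)
        where
        5≤card : 5 ≤ card U
        5≤card = ≤-trans (+-mono-≤ (card-∋ {n} {U ∖ N[ y ]} x∈U∖N[y]) (4≤deg y (∧-elimˡ Wy)))
                         (≤-reflexive (card-∖N[] U y))

      avoiding-y : Bounded 3 (suc s) k (count n (λ S → P S ∧ not (R S)))
      avoiding-y = bounded-mono-m (count-cover n cover)
        (subst (λ c → Bounded c (suc s) k (sum (λ w → count n (λ S → (W ∖ ⁅ y ⁆ᵇ) w ∧ (w ∈ᵇ S ∧ P S)))))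
               card-W∖y (bounded-∑branch ih (W ∖ ⁅ y ⁆ᵇ) W∖y-ok))
        where
        card-W∖y : card (W ∖ ⁅ y ⁆ᵇ) ≡ 3
        card-W∖y = suc-injective (begin-equality
          1 + card (W ∖ ⁅ y ⁆ᵇ)                 ≡⟨ cong (_+ card (W ∖ ⁅ y ⁆ᵇ)) (sym (card-∩⁅⁆ {n} {W} Wy)) ⟩
          card (W ∩ ⁅ y ⁆ᵇ) + card (W ∖ ⁅ y ⁆ᵇ) ≡⟨ sym (card-split W ⁅ y ⁆ᵇ) ⟩
          card W                                ≡⟨ deg≡4 ⟩
          4                                     ∎)
        W∖y-ok : ∀ w → (W ∖ ⁅ y ⁆ᵇ) w ≡ true → U w ≡ true × card U ≤ suc s + deg U w
        W∖y-ok w Ww = let Uw = ∧-elimˡ (∧-elimˡ Ww) in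
          Uw , ≤-trans (≤-reflexive card≡) (+-monoʳ-≤ (suc s) (4≤deg w Uw))
        cover : ∀ S → (P S ∧ not (R S)) ≡ true → ∃ λ w → ((W ∖ ⁅ y ⁆ᵇ) w ∧ (w ∈ᵇ S ∧ P S)) ≡ true
        cover S h with misIn-meets-N[] Uv (misIn-sound {U} {suc k} {S} (∧-elimˡ h))
        ... | w , Ww , w∈S with y ≟ w
        ... | no y≢w   = w , ∧-intro (∧-intro Ww (not-false (dec-false (y ≟ w) y≢w))) (∧-intro w∈S (∧-elimˡ h))
        ... | yes refl = x , ∧-intro (∧-intro Wx (not-false (dec-false (y ≟ x) y≢x))) (∧-intro x∈S (∧-elimˡ h))
          where
          x∈S : x ∈ᵇ S ≡ true
          x∈S = ¬-not λ x∉S → not-¬ (∧-intro w∈S (not-false x∉S)) (not-true (∧-elimʳ {P S} h))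

      containing-y : Bounded 1 s k (count n (λ S → P S ∧ R S))
      containing-y = bounded-mono-m (≤-trans (count-mono n cover) (count-branch {U ∖ ⁅ x ⁆ᵇ} y))
        (bounded-mono-N (s≤s⁻¹ card-U′) (ih U′ (≤-trans card-U′ (≤-trans (m≤m+n (suc s) 4) (≤-reflexive (sym card≡)))) k))
        where
        U′ : Fin n → Bool
        U′ = U ∖ ⁅ x ⁆ᵇ ∖ N[ y ]
        U′⊆U∖N[y] : ∀ i → U′ i ≡ true → (U ∖ N[ y ]) i ≡ true
        U′⊆U∖N[y] i h = ∧-intro (∧-elimˡ (∧-elimˡ h)) (∧-elimʳ {U i ∧ not (does (x ≟ i))} h)
        U′x : U′ x ≡ false
        U′x = cong (_∧ not (N[ y ] x)) (trans (cong (λ b → U x ∧ not b) (dec-true (x ≟ x) refl)) (∧-zeroʳ (U x)))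
        card-U′ : suc (card U′) ≤ suc s
        card-U′ = +-cancelʳ-≤ 4 _ _ (begin
          suc (card U′) + 4                ≤⟨ +-mono-≤ (card-< U′⊆U∖N[y] x∈U∖N[y] U′x) (4≤deg y (∧-elimˡ Wy)) ⟩
          card (U ∖ N[ y ]) + deg U y      ≡⟨ card-∖N[] U y ⟩
          card U                           ≡⟨ card≡ ⟩
          suc s + 4                        ∎)
        cover : ∀ S → (P S ∧ R S) ≡ true → (y ∈ᵇ S ∧ misIn (U ∖ ⁅ x ⁆ᵇ) (suc k) S) ≡ true
        cover S h = ∧-intro (∧-elimˡ {y ∈ᵇ S} (∧-elimʳ {P S} h))
          (misIn-complete {U ∖ ⁅ x ⁆ᵇ} {suc k} {S} (misIn-restrict (λ i → ∧-elimˡ {U i}) S⊆U∖x M))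
          where
          M : MaximalIndependentIn U (suc k) S
          M = misIn-sound (∧-elimˡ h)
          x∉S : x ∈ᵇ S ≡ false
          x∉S = not-true (∧-elimʳ {y ∈ᵇ S} (∧-elimʳ {P S} h))
          S⊆U∖x : ∀ i → i ∈ᵇ S ≡ true → (U ∖ ⁅ x ⁆ᵇ) i ≡ true
          S⊆U∖x i i∈S with x ≟ i
          ... | yes refl = contradiction x∉S (not-¬ i∈S)
          ... | no _     = ∧-intro (⊆U M i i∈S) refl

      bounded-deg≡4 : Bounded 1 (card U) (suc k) (count n P)
      bounded-deg≡4 = subst (λ N → Bounded 1 N (suc k) (count n P)) (trans (+-suc s 4) (sym card≡))
        (bounded-mono-m (≤-reflexive split) (bounded-step-4 avoiding-y containing-y))
        where
        split : count n P ≡ count n (λ S → P S ∧ not (R S)) + count n (λ S → P S ∧ R S)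
        split = trans (count-split n P R) (+-comm (count n (λ S → P S ∧ R S)) _)

    boundedIn-step : ∀ U → BoundedBelow U → BoundedIn U
    boundedIn-step U ih zero    = bounded-≤1 (≤-trans (count-mono n size≡0) (≤-reflexive (count-empty n)))
      where
      size≡0 : ∀ S → misIn U 0 S ≡ true → (∣ S ∣ ≡ᵇ 0) ≡ true
      size≡0 S h = ≡ᵇ-complete (size (misIn-sound {U} {0} {S} h))
    boundedIn-step U ih (suc k) with any U (allFin n) in eq
    ... | false = bounded-mono-m (≤-reflexive (count-∅ n empty)) (bounded z≤n)
      where
      empty : ∀ S → misIn U (suc k) S ≡ false
      empty S = ¬-not λ h → let M = misIn-sound {U} {suc k} {S} h
                                i , i∈S = ∣S∣≡suc⇒nonempty S (size M)
                            in not-¬ (any-allFin⁺ U i (⊆U M i i∈S)) eq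
    ... | true with argmin U (deg U) (proj₂ (any-allFin⁻ U eq))
    ... | v , Uv , minimal with deg U v ≟ℕ 4
    ... | no deg≢4  = bounded-deg≢4 ih Uv minimal deg≢4
    ... | yes deg≡4 with K4Free⇒nonadjacent K4 (U ∩ N[ v ]) (≤-reflexive (sym deg≡4))
    ... | x , y , Wx , Wy , y≢x , x≁y = Degree4.bounded-deg≡4 ih Uv minimal deg≡4 Wx Wy y≢x x≁y

    boundedIn : ∀ N U → card U ≤ N → BoundedIn U
    boundedIn zero    U card≤0 = boundedIn-step U λ U′ lt → contradiction (≤-trans lt card≤0) λ ()
    boundedIn (suc N) U card≤N = boundedIn-step U λ U′ lt → boundedIn N U′ (s≤s⁻¹ (≤-trans lt card≤N))

    mis-bound : ∀ k → mis k G * lhs n k ≤ 1 * rhs n k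
    mis-bound k = Bounded.bound (bounded-mono-m (mis≤count-misIn k)
      (subst (λ N → Bounded 1 N k (count n (misIn (λ _ → true) k))) (card-⊤ n)
             (boundedIn n (λ _ → true) (≤-reflexive (card-⊤ n)) k)))

  -- Weighted AM-GM

  2ab≤a²+b² : ∀ a b → 2 * a * b ≤ a * a + b * b
  2ab≤a²+b² a b = [ ordered , (λ b≤a → subst₂ _≤_ (swap b a) (+-comm (b * b) (a * a)) (ordered b≤a)) ]′ (≤-total a b)
    where
    swap : ∀ b a → 2 * b * a ≡ 2 * a * b
    swap = solve-∀
    square : ∀ a d → 2 * a * (a + d) + d * d ≡ a * a + (a + d) * (a + d)
    square = solve-∀
    ordered : ∀ {a b} → a ≤ b → 2 * a * b ≤ a * a + b * b
    ordered {a} a≤b with d , refl ← m≤n⇒∃[o]m+o≡n a≤b = ≤-trans (m≤m+n _ (d * d)) (≤-reflexive (square a d))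

  amgm-one-many : ∀ N a b → suc N * a * b ^ N ≤ a ^ suc N + N * b ^ suc N
  amgm-one-many zero    a b = ≤-reflexive (base a)
    where
    base : ∀ a → 1 * a * 1 ≡ a * 1 + 0
    base = solve-∀
  amgm-one-many (suc N) a b = +-cancelʳ-≤ (N * a * b * b ^ N) _ _ (begin
    (2 + N) * a * (b * b ^ N) + N * a * b * b ^ N               ≡⟨ e₁ N a b (b ^ N) ⟩
    (1 + N) * b ^ N * (2 * a * b)                               ≤⟨ *-monoʳ-≤ ((1 + N) * b ^ N) (2ab≤a²+b² a b) ⟩
    (1 + N) * b ^ N * (a * a + b * b)                           ≡⟨ e₂ N a b (b ^ N) ⟩
    a * ((1 + N) * a * b ^ N) + (1 + N) * (b * (b * b ^ N))     ≤⟨ +-monoˡ-≤ _ (*-monoʳ-≤ a (amgm-one-many N a b)) ⟩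
    a * (a ^ suc N + N * (b * b ^ N)) + (1 + N) * (b * (b * b ^ N))
                                                                ≡⟨ e₃ N a b (b ^ N) (a ^ suc N) ⟩
    a * a ^ suc N + (1 + N) * (b * (b * b ^ N)) + N * a * b * b ^ N ∎)
    where
    open ≤-Reasoning
    e₁ : ∀ N a b x → (2 + N) * a * (b * x) + N * a * b * x ≡ (1 + N) * x * (2 * a * b)
    e₁ = solve-∀
    e₂ : ∀ N a b x → (1 + N) * x * (a * a + b * b) ≡ a * ((1 + N) * a * x) + (1 + N) * (b * (b * x))
    e₂ = solve-∀
    e₃ : ∀ N a b x y → a * (y + N * (b * x)) + (1 + N) * (b * (b * x)) ≡
                       a * y + (1 + N) * (b * (b * x)) + N * a * b * x
    e₃ = solve-∀

  amgm-extend : ∀ n S x → 1 ≤ n → suc n ^ suc n * S ^ n * x ≤ n ^ n * (S + x) ^ suc n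
  amgm-extend n S x 1≤n = *-cancelˡ-≤ n {{>-nonZero 1≤n}} (+-cancelʳ-≤ D _ _ (begin
    n * (suc n * P * Sⁿ * x) + D                 ≡⟨ e₁ n S x P Sⁿ ⟩
    suc n * (n * (S + x)) * (P * Sⁿ)             ≡⟨ cong (suc n * (n * (S + x)) *_) (sym (^-distribʳ-* (suc n) S n)) ⟩
    suc n * (n * (S + x)) * (suc n * S) ^ n      ≤⟨ amgm-one-many n (n * (S + x)) (suc n * S) ⟩
    (n * (S + x)) ^ suc n + n * (suc n * S) ^ suc n
                                                 ≡⟨ cong₂ (λ u v → u + n * v) (^-distribʳ-* n (S + x) (suc n))
                                                                              (^-distribʳ-* (suc n) S (suc n)) ⟩
    n * n ^ n * T + D                            ≡⟨ cong (_+ D) (*-assoc n (n ^ n) T) ⟩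
    n * (n ^ n * T) + D                          ∎))
    where
    open ≤-Reasoning
    P Sⁿ T D : ℕ
    P  = suc n ^ n
    Sⁿ = S ^ n
    T  = (S + x) ^ suc n
    D  = n * (suc n * P * (S * Sⁿ))
    e₁ : ∀ n S x P Sⁿ → n * (suc n * P * Sⁿ * x) + n * (suc n * P * (S * Sⁿ)) ≡
                        suc n * (n * (S + x)) * (P * Sⁿ)
    e₁ = solve-∀

  weighted-amgm : ∀ i j a b → 1 ≤ i → (i + j) ^ (i + j) * (a ^ i * b ^ j) ≤ (i * a + j * b) ^ (i + j)
  weighted-amgm i zero a b _ = ≤-reflexive (begin-equality
    (i + 0) ^ (i + 0) * (a ^ i * 1) ≡⟨ cong₂ (λ u v → u ^ u * v) (+-identityʳ i) (*-identityʳ (a ^ i)) ⟩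
    i ^ i * a ^ i                   ≡⟨ sym (^-distribʳ-* i a i) ⟩
    (i * a) ^ i                     ≡⟨ cong₂ _^_ (sym (+-identityʳ (i * a))) (sym (+-identityʳ i)) ⟩
    (i * a + 0) ^ (i + 0)           ∎)
    where
    open ≤-Reasoning
  weighted-amgm i (suc j) a b 1≤i =
    subst₂ (λ u v → u ^ u * (a ^ i * b ^ suc j) ≤ v ^ u) (sym (+-suc i j)) (add-b i j a b) step
    where
    open ≤-Reasoning
    n S : ℕ
    n = i + j
    S = i * a + j * b
    1≤n : 1 ≤ n
    1≤n = ≤-trans 1≤i (m≤m+n i j)
    add-b : ∀ i j a b → i * a + j * b + b ≡ i * a + suc j * b
    add-b = solve-∀
    reorder : ∀ R Q x b y → Q * (R * (x * (b * y))) ≡ R * (Q * (x * y)) * b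
    reorder = solve-∀
    step : suc n ^ suc n * (a ^ i * b ^ suc j) ≤ (S + b) ^ suc n
    step = *-cancelˡ-≤ (n ^ n) {{m^n≢0 n n {{>-nonZero 1≤n}}}} (begin
      n ^ n * (suc n ^ suc n * (a ^ i * (b * b ^ j)))   ≡⟨ reorder (suc n ^ suc n) (n ^ n) (a ^ i) b (b ^ j) ⟩
      suc n ^ suc n * (n ^ n * (a ^ i * b ^ j)) * b     ≤⟨ *-monoˡ-≤ b (*-monoʳ-≤ (suc n ^ suc n) (weighted-amgm i j a b 1≤i)) ⟩
      suc n ^ suc n * S ^ n * b                         ≤⟨ amgm-extend n S b 1≤n ⟩
      n ^ n * (S + b) ^ suc n                           ∎)

  -- 5q (weight q) and α (weight p) have weighted mean β = α + q.
  amgm-5q : ∀ q p α → 1 ≤ q → α + p ≡ 4 * q → (5 * q) ^ q * α ^ p ≤ (α + q) ^ (q + p)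
  amgm-5q q p α 1≤q α+p≡4q = *-cancelˡ-≤ K {{m^n≢0 (q + p) (q + p) {{>-nonZero (≤-trans 1≤q (m≤m+n q p))}}}} (begin
    K * ((5 * q) ^ q * α ^ p)         ≤⟨ weighted-amgm q p (5 * q) α 1≤q ⟩
    (q * (5 * q) + p * α) ^ (q + p)   ≡⟨ cong (_^ (q + p)) mean ⟩
    ((q + p) * (α + q)) ^ (q + p)     ≡⟨ ^-distribʳ-* (q + p) (α + q) (q + p) ⟩
    K * (α + q) ^ (q + p)             ∎)
    where
    open ≤-Reasoning
    K : ℕ
    K = (q + p) ^ (q + p)
    expand : ∀ q p α → (q + p) * (α + q) ≡ q * (α + p) + q * q + p * α
    expand = solve-∀
    collect : ∀ q p α → q * (4 * q) + q * q + p * α ≡ q * (5 * q) + p * α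
    collect = solve-∀
    mean : q * (5 * q) + p * α ≡ (q + p) * (α + q)
    mean = sym (trans (expand q p α) (trans (cong (λ z → q * z + q * q + p * α) α+p≡4q) (collect q p α)))

  module IntegralForm (q p α : ℕ) (1≤q : 1 ≤ q) (1≤α : 1 ≤ α) (α+p≡4q : α + p ≡ 4 * q) where

    β : ℕ
    β = α + q

    α+[q+p]≡5q : α + (q + p) ≡ 5 * q
    α+[q+p]≡5q = trans (regroup α q p) (trans (cong (_+ q) α+p≡4q) (4q+q q))
      where
      regroup : ∀ a q p → a + (q + p) ≡ a + p + q
      regroup = solve-∀
      4q+q : ∀ q → 4 * q + q ≡ 5 * q
      4q+q = solve-∀

    β+p≡5q : β + p ≡ 5 * q
    β+p≡5q = trans (+-assoc α q p) α+[q+p]≡5q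

    ^-5kq : ∀ x a b k → a + b ≡ 5 * q → x ^ (5 * k * q) ≡ x ^ (a * k) * x ^ (b * k)
    ^-5kq x a b k a+b≡5q = begin-equality
      x ^ (5 * k * q)          ≡⟨ cong (x ^_) (trans (swap k q) (cong (_* k) (sym a+b≡5q))) ⟩
      x ^ ((a + b) * k)        ≡⟨ cong (x ^_) (*-distribʳ-+ k a b) ⟩
      x ^ (a * k + b * k)      ≡⟨ ^-distribˡ-+-* x (a * k) (b * k) ⟩
      x ^ (a * k) * x ^ (b * k) ∎
      where
      open ≤-Reasoning
      swap : ∀ k q → 5 * k * q ≡ 5 * q * k
      swap = solve-∀

    lhs-power : ∀ n k m → (m * (β ^ (5 * k) * α ^ n)) ^ q * ((5 * q) ^ q) ^ k ≡
                m ^ q * α ^ (n * q) * β ^ (α * k) * q ^ (q * k) * (5 ^ (q * k) * β ^ ((q + p) * k))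
    lhs-power n k m = begin-equality
      (m * (β ^ (5 * k) * α ^ n)) ^ q * ((5 * q) ^ q) ^ k
        ≡⟨ cong₂ _*_ (trans (^-distribʳ-* m _ q) (cong (m ^ q *_) (^-distribʳ-* (β ^ (5 * k)) (α ^ n) q)))
                     (trans (^-*-assoc (5 * q) q k) (^-distribʳ-* 5 q (q * k))) ⟩
      m ^ q * ((β ^ (5 * k)) ^ q * (α ^ n) ^ q) * (5 ^ (q * k) * q ^ (q * k))
        ≡⟨ cong (λ x → m ^ q * x * (5 ^ (q * k) * q ^ (q * k)))
                (cong₂ _*_ (trans (^-*-assoc β (5 * k) q) (^-5kq β α (q + p) k α+[q+p]≡5q)) (^-*-assoc α n q)) ⟩
      m ^ q * (β ^ (α * k) * β ^ ((q + p) * k) * α ^ (n * q)) * (5 ^ (q * k) * q ^ (q * k))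
        ≡⟨ reorder (m ^ q) (β ^ (α * k)) (β ^ ((q + p) * k)) (α ^ (n * q)) (5 ^ (q * k)) (q ^ (q * k)) ⟩
      m ^ q * α ^ (n * q) * β ^ (α * k) * q ^ (q * k) * (5 ^ (q * k) * β ^ ((q + p) * k)) ∎
      where
      open ≤-Reasoning
      reorder : ∀ M Bα Bqp An F Qk → M * (Bα * Bqp * An) * (F * Qk) ≡ M * An * Bα * Qk * (F * Bqp)
      reorder = solve-∀

    rhs-power : ∀ n k → (5 ^ k * β ^ n * α ^ (5 * k)) ^ q * ((5 * q) ^ q) ^ k ≡
                α ^ (β * k) * β ^ (n * q) * 5 ^ (q * k) * ((5 * q) ^ q * α ^ p) ^ k
    rhs-power n k = begin-equality
      (5 ^ k * β ^ n * α ^ (5 * k)) ^ q * ((5 * q) ^ q) ^ k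
        ≡⟨ cong (_* ((5 * q) ^ q) ^ k) (trans (^-distribʳ-* (5 ^ k * β ^ n) (α ^ (5 * k)) q)
                                              (cong (_* (α ^ (5 * k)) ^ q) (^-distribʳ-* (5 ^ k) (β ^ n) q))) ⟩
      (5 ^ k) ^ q * (β ^ n) ^ q * (α ^ (5 * k)) ^ q * ((5 * q) ^ q) ^ k
        ≡⟨ cong₂ (λ x y → x * (β ^ n) ^ q * y * ((5 * q) ^ q) ^ k)
                 (trans (^-*-assoc 5 k q) (cong (5 ^_) (*-comm k q)))
                 (trans (^-*-assoc α (5 * k) q) (^-5kq α β p k β+p≡5q)) ⟩
      5 ^ (q * k) * (β ^ n) ^ q * (α ^ (β * k) * α ^ (p * k)) * ((5 * q) ^ q) ^ k
        ≡⟨ cong₂ (λ x y → 5 ^ (q * k) * x * (α ^ (β * k) * y) * ((5 * q) ^ q) ^ k)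
                 (^-*-assoc β n q) (sym (^-*-assoc α p k)) ⟩
      5 ^ (q * k) * β ^ (n * q) * (α ^ (β * k) * (α ^ p) ^ k) * ((5 * q) ^ q) ^ k
        ≡⟨ reorder (5 ^ (q * k)) (β ^ (n * q)) (α ^ (β * k)) ((α ^ p) ^ k) (((5 * q) ^ q) ^ k) ⟩
      α ^ (β * k) * β ^ (n * q) * 5 ^ (q * k) * (((5 * q) ^ q) ^ k * (α ^ p) ^ k)
        ≡⟨ cong (α ^ (β * k) * β ^ (n * q) * 5 ^ (q * k) *_) (sym (^-distribʳ-* ((5 * q) ^ q) (α ^ p) k)) ⟩
      α ^ (β * k) * β ^ (n * q) * 5 ^ (q * k) * ((5 * q) ^ q * α ^ p) ^ k ∎
      where
      open ≤-Reasoning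
      reorder : ∀ F Bn Aβ Ap X → F * Bn * (Aβ * Ap) * X ≡ Aβ * Bn * F * (X * Ap)
      reorder = solve-∀

    -- Raising to the q-th power and multiplying by E = 5^(qk) β^((q+p)k) turns the factor 5^k into
    -- ((5q)^q α^p)^k, which AM–GM bounds by β^((q+p)k).
    integral-form : ∀ n k m → m * (β ^ (5 * k) * α ^ n) ≤ 1 * (5 ^ k * β ^ n * α ^ (5 * k)) →
                    m ^ q * α ^ (n * q) * β ^ (α * k) * q ^ (q * k) ≤ α ^ (β * k) * β ^ (n * q)
    integral-form n k m h = *-cancelʳ-≤ _ _ E {{E≢0}} (begin
      m ^ q * α ^ (n * q) * β ^ (α * k) * q ^ (q * k) * E       ≡⟨ sym (lhs-power n k m) ⟩
      (m * (β ^ (5 * k) * α ^ n)) ^ q * ((5 * q) ^ q) ^ k        ≤⟨ *-monoˡ-≤ (((5 * q) ^ q) ^ k) (^-monoˡ-≤ q h′) ⟩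
      (5 ^ k * β ^ n * α ^ (5 * k)) ^ q * ((5 * q) ^ q) ^ k      ≡⟨ rhs-power n k ⟩
      C * ((5 * q) ^ q * α ^ p) ^ k                              ≤⟨ *-monoʳ-≤ C (^-monoˡ-≤ k (amgm-5q q p α 1≤q α+p≡4q)) ⟩
      C * (β ^ (q + p)) ^ k                                      ≡⟨ trans (cong (C *_) (^-*-assoc β (q + p) k))
                                                                          (*-assoc (α ^ (β * k) * β ^ (n * q)) (5 ^ (q * k)) _) ⟩
      α ^ (β * k) * β ^ (n * q) * E                              ∎)
      where
      open ≤-Reasoning
      h′ : m * (β ^ (5 * k) * α ^ n) ≤ 5 ^ k * β ^ n * α ^ (5 * k)
      h′ = ≤-trans h (≤-reflexive (*-identityˡ _))
      C E : ℕ
      C = α ^ (β * k) * β ^ (n * q) * 5 ^ (q * k)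
      E = 5 ^ (q * k) * β ^ ((q + p) * k)
      E≢0 : NonZero E
      E≢0 = m*n≢0 (5 ^ (q * k)) (β ^ ((q + p) * k))
              {{m^n≢0 5 (q * k)}} {{m^n≢0 β ((q + p) * k) {{>-nonZero (≤-trans 1≤α (m≤m+n α q))}}}}

-- Passing to rational exponents

module _ where
  open import Algebra.Bundles using (CommutativeMonoid)
  open import Data.Empty using (⊥-elim)
  open import Data.Integer as ℤ using (+_; +[1+_]; -[1+_]; _⊖_)
  import Data.Integer.Properties as ℤₚ
  open import Data.Nat as ℕ using (zero; suc; _∸_; z≤n; s≤s)
  import Data.Nat.Coprimality as Coprimality
  import Data.Nat.Properties as ℕₚ
  open import Data.Rational as ℚ using (mkℚ; Positive; _*_; _+_; _-_; -_) renaming (_≤_ to _≤ℚ_)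
  import Data.Rational.Properties as ℚₚ
  open import Data.Rational.Solver using (module +-*-Solver)
  import Data.Rational.Unnormalised as ℚᵘ
  open import Relation.Binary.PropositionalEquality
  open import Relation.Nullary using (yes; no)
  open import Relation.Nullary.Decidable using (toWitness)

  open +-*-Solver using (solve; _:*_; _:=_)
  open import Algebra.Properties.CommutativeSemigroup (CommutativeMonoid.commutativeSemigroup ℚₚ.*-1-commutativeMonoid)
    using (interchange; x∙yz≈y∙xz)

  ℕ→ℚ-mkℚ : ∀ m → ℕ→ℚ m ≡ mkℚ (+ m) 0 (Coprimality.sym (Coprimality.1-coprimeTo m))
  ℕ→ℚ-mkℚ m = ℚₚ.normalize-coprime (Coprimality.sym (Coprimality.1-coprimeTo m))

  ℕ→ℚ-* : ∀ a b → ℕ→ℚ (a ℕ.* b) ≡ ℕ→ℚ a * ℕ→ℚ b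
  ℕ→ℚ-* a b rewrite ℕ→ℚ-mkℚ a | ℕ→ℚ-mkℚ b = cong (ℚ._/ 1) (ℤₚ.pos-* a b)

  ℕ→ℚ-+ : ∀ a b → ℕ→ℚ (a ℕ.+ b) ≡ ℕ→ℚ a + ℕ→ℚ b
  ℕ→ℚ-+ a b rewrite ℕ→ℚ-mkℚ a | ℕ→ℚ-mkℚ b =
    cong (ℚ._/ 1) (trans (ℤₚ.pos-+ a b) (sym (cong₂ ℤ._+_ (ℤₚ.*-identityʳ (+ a)) (ℤₚ.*-identityʳ (+ b)))))

  ℕ→ℚ-mono-≤ : ∀ {a b} → a ≤ b → ℕ→ℚ a ≤ℚ ℕ→ℚ b
  ℕ→ℚ-mono-≤ {a} {b} a≤b rewrite ℕ→ℚ-mkℚ a | ℕ→ℚ-mkℚ b =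
    ℚ.*≤* (subst₂ ℤ._≤_ (sym (ℤₚ.*-identityʳ (+ a))) (sym (ℤₚ.*-identityʳ (+ b))) (ℤ.+≤+ a≤b))

  ℕ→ℚ-positive : ∀ m → 1 ≤ m → Positive (ℕ→ℚ m)
  ℕ→ℚ-positive (suc m) _ = subst Positive (sym (ℕ→ℚ-mkℚ (suc m))) _

  ^ℕ-+ : ∀ x i j → x ^ℕ (i ℕ.+ j) ≡ x ^ℕ i * x ^ℕ j
  ^ℕ-+ x zero    j = sym (ℚₚ.*-identityˡ _)
  ^ℕ-+ x (suc i) j = trans (cong (x *_) (^ℕ-+ x i j)) (sym (ℚₚ.*-assoc x _ _))

  ^ℕ-distribʳ-* : ∀ x y i → (x * y) ^ℕ i ≡ x ^ℕ i * y ^ℕ i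
  ^ℕ-distribʳ-* x y zero    = refl
  ^ℕ-distribʳ-* x y (suc i) = trans (cong (x * y *_) (^ℕ-distribʳ-* x y i)) (interchange x y (x ^ℕ i) (y ^ℕ i))

  ℕ→ℚ-^ : ∀ a i → ℕ→ℚ (a ℕ.^ i) ≡ ℕ→ℚ a ^ℕ i
  ℕ→ℚ-^ a zero    = refl
  ℕ→ℚ-^ a (suc i) = trans (ℕ→ℚ-* a (a ℕ.^ i)) (cong (ℕ→ℚ a *_) (ℕ→ℚ-^ a i))

  ^ℕ-positive : ∀ x → Positive x → ∀ i → Positive (x ^ℕ i)
  ^ℕ-positive x x>0 zero    = _
  ^ℕ-positive x x>0 (suc i) = ℚₚ.pos*pos⇒pos x {{x>0}} (x ^ℕ i) {{^ℕ-positive x x>0 i}}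

  inv-inverseˡ : ∀ x → Positive x → inv x * x ≡ ℚ.1ℚ
  inv-inverseˡ x x>0 with x ℚₚ.≟ ℚ.0ℚ
  ... | yes x≡0 = ⊥-elim (ℚₚ.<-irrefl (sym x≡0) (ℚₚ.positive⁻¹ x {{x>0}}))
  ... | no x≢0  = ℚₚ.*-inverseˡ x {{ℚ.≢-nonZero x≢0}}

  ^ℤ-⊖ : ∀ x → Positive x → ∀ u v → x ^ℤ (u ⊖ v) * x ^ℕ v ≡ x ^ℕ u
  ^ℤ-⊖ x x>0 u       zero    = ℚₚ.*-identityʳ _
  ^ℤ-⊖ x x>0 zero    (suc v) = inv-inverseˡ (x ^ℕ suc v) (^ℕ-positive x x>0 (suc v))
  ^ℤ-⊖ x x>0 (suc u) (suc v) rewrite ℤₚ.[1+m]⊖[1+n]≡m⊖n u v =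
    trans (x∙yz≈y∙xz (x ^ℤ (u ⊖ v)) x (x ^ℕ v)) (cong (x *_) (^ℤ-⊖ x x>0 u v))

  ≤-^ℤ : ∀ x y {L} → Positive x → Positive y → ∀ u v u′ v′ →
         L * (x ^ℕ v * y ^ℕ v′) ≤ℚ x ^ℕ u * y ^ℕ u′ → L ≤ℚ x ^ℤ (u ⊖ v) * y ^ℤ (u′ ⊖ v′)
  ≤-^ℤ x y {L} x>0 y>0 u v u′ v′ h =
    ℚₚ.*-cancelʳ-≤-pos (x ^ℕ v * y ^ℕ v′) {{xy>0}} (subst (L * (x ^ℕ v * y ^ℕ v′) ≤ℚ_) (sym cancelled) h)
    where
    xy>0 : Positive (x ^ℕ v * y ^ℕ v′)
    xy>0 = ℚₚ.pos*pos⇒pos (x ^ℕ v) {{^ℕ-positive x x>0 v}} (y ^ℕ v′) {{^ℕ-positive y y>0 v′}}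
    cancelled : x ^ℤ (u ⊖ v) * y ^ℤ (u′ ⊖ v′) * (x ^ℕ v * y ^ℕ v′) ≡ x ^ℕ u * y ^ℕ u′
    cancelled = trans (interchange (x ^ℤ (u ⊖ v)) _ _ _) (cong₂ _*_ (^ℤ-⊖ x x>0 u v) (^ℤ-⊖ y y>0 u′ v′))

  positive-scaled : ∀ x Q → Positive Q → ∀ r → x * Q ≡ ℕ→ℚ r → 1 ≤ r → Positive x
  positive-scaled x Q Q>0 r xQ≡r 1≤r = ℚ.positive {x} (ℚₚ.*-cancelʳ-<-nonNeg Q {{ℚₚ.pos⇒nonNeg Q {{Q>0}}}} 0<xQ)
    where
    0<xQ : ℚ.0ℚ * Q < x * Q
    0<xQ = subst₂ _<_ (sym (ℚₚ.*-zeroˡ Q)) (sym xQ≡r) (ℚₚ.positive⁻¹ (ℕ→ℚ r) {{ℕ→ℚ-positive r 1≤r}})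

  module BelowHalf (p-1 d : ℕ) .(c : Coprimality.Coprime (suc p-1) (suc d)) (p*2<q : suc p-1 ℕ.* 2 ℕ.< 1 ℕ.* suc d) where

    η : ℚ
    η = mkℚ +[1+ p-1 ] d c

    p q α β : ℕ
    p = suc p-1
    q = suc d
    α = 4 ℕ.* q ∸ p
    β = α ℕ.+ q

    2p≤q : 2 ℕ.* p ≤ q
    2p≤q = subst₂ _≤_ (ℕₚ.*-comm p 2) (ℕₚ.*-identityˡ q) (ℕₚ.<⇒≤ p*2<q)

    α+p≡4q : α ℕ.+ p ≡ 4 ℕ.* q
    α+p≡4q = ℕₚ.m∸n+n≡m (ℕₚ.≤-trans (ℕₚ.m≤n*m p 2) (ℕₚ.≤-trans 2p≤q (ℕₚ.m≤n*m q 4)))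

    β+p≡5q : β ℕ.+ p ≡ 5 ℕ.* q
    β+p≡5q = trans (ℕₚ.+-assoc α q p) (trans (cong (α ℕ.+_) (ℕₚ.+-comm q p))
                   (trans (sym (ℕₚ.+-assoc α p q)) (trans (cong (ℕ._+ q) α+p≡4q) (ℕₚ.+-comm (4 ℕ.* q) q))))

    7q≤2α : 7 ℕ.* q ≤ 2 ℕ.* α
    7q≤2α = ℕₚ.+-cancelʳ-≤ (2 ℕ.* p) _ _ (begin
      7 ℕ.* q ℕ.+ 2 ℕ.* p  ≤⟨ ℕₚ.+-monoʳ-≤ (7 ℕ.* q) 2p≤q ⟩
      7 ℕ.* q ℕ.+ q        ≡⟨ trans (ℕₚ.+-comm (7 ℕ.* q) q) (ℕₚ.*-assoc 2 4 q) ⟩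
      2 ℕ.* (4 ℕ.* q)      ≡⟨ cong (2 ℕ.*_) (sym α+p≡4q) ⟩
      2 ℕ.* (α ℕ.+ p)      ≡⟨ ℕₚ.*-distribˡ-+ 2 α p ⟩
      2 ℕ.* α ℕ.+ 2 ℕ.* p  ∎)
      where open ℕₚ.≤-Reasoning

    1≤α : 1 ≤ α
    1≤α = ℕₚ.*-cancelˡ-≤ 2 (ℕₚ.≤-trans (ℕₚ.≤-trans (ℕₚ.m≤m+n 2 5) (ℕₚ.m≤m*n 7 q)) 7q≤2α)

    6α≤5β : 6 ℕ.* α ≤ 5 ℕ.* β
    6α≤5β = begin
      6 ℕ.* α                ≡⟨ ℕₚ.*-distribʳ-+ α 5 1 ⟩
      5 ℕ.* α ℕ.+ 1 ℕ.* α    ≤⟨ ℕₚ.+-monoʳ-≤ (5 ℕ.* α) α≤5q ⟩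
      5 ℕ.* α ℕ.+ 5 ℕ.* q    ≡⟨ sym (ℕₚ.*-distribˡ-+ 5 α q) ⟩
      5 ℕ.* β                ∎
      where
      open ℕₚ.≤-Reasoning
      α≤5q : 1 ℕ.* α ≤ 5 ℕ.* q
      α≤5q = ℕₚ.≤-trans (ℕₚ.≤-reflexive (ℕₚ.*-identityˡ α))
               (ℕₚ.≤-trans (ℕₚ.m∸n≤m (4 ℕ.* q) p) (ℕₚ.*-monoˡ-≤ q (ℕₚ.n≤1+n 4)))

    7β≤9α : 7 ℕ.* β ≤ 9 ℕ.* α
    7β≤9α = begin
      7 ℕ.* (α ℕ.+ q)        ≡⟨ ℕₚ.*-distribˡ-+ 7 α q ⟩
      7 ℕ.* α ℕ.+ 7 ℕ.* q    ≤⟨ ℕₚ.+-monoʳ-≤ (7 ℕ.* α) 7q≤2α ⟩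
      7 ℕ.* α ℕ.+ 2 ℕ.* α    ≡⟨ sym (ℕₚ.*-distribʳ-+ α 7 2) ⟩
      9 ℕ.* α                ∎
      where open ℕₚ.≤-Reasoning

    Q A B : ℚ
    Q = ℕ→ℚ q
    A = ℕ→ℚ 4 - η
    B = ℕ→ℚ 5 - η

    Q>0 : Positive Q
    Q>0 = ℕ→ℚ-positive q (s≤s z≤n)

    ηQ≡p : η * Q ≡ ℕ→ℚ p
    ηQ≡p rewrite ℕ→ℚ-mkℚ q = ℚₚ.fromℚᵘ-cong {ℚᵘ.mkℚᵘ (+ p ℤ.* + q) (d ℕ.* 1)} {ℚᵘ.mkℚᵘ (+ p) 0} (ℚᵘ.*≡* (begin-equality
      + p ℤ.* + q ℤ.* + 1           ≡⟨ ℤₚ.*-identityʳ (+ p ℤ.* + q) ⟩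
      + p ℤ.* + q                   ≡⟨ cong (λ e → + p ℤ.* + suc e) (sym (ℕₚ.*-identityʳ d)) ⟩
      + p ℤ.* + suc (d ℕ.* 1)       ∎))
      where open ℤₚ.≤-Reasoning

    scaled-difference : ∀ c r → c ℕ.* q ≡ r ℕ.+ p → (ℕ→ℚ c - η) * Q ≡ ℕ→ℚ r
    scaled-difference c r cq≡r+p = begin
      (ℕ→ℚ c - η) * Q               ≡⟨ ℚₚ.*-distribʳ-+ Q (ℕ→ℚ c) (- η) ⟩
      ℕ→ℚ c * Q + - η * Q           ≡⟨ cong₂ _+_ (sym (ℕ→ℚ-* c q)) (sym (ℚₚ.neg-distribˡ-* η Q)) ⟩
      ℕ→ℚ (c ℕ.* q) + - (η * Q)     ≡⟨ cong₂ (λ u v → ℕ→ℚ u + - v) cq≡r+p ηQ≡p ⟩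
      ℕ→ℚ (r ℕ.+ p) + - ℕ→ℚ p       ≡⟨ cong (_+ - ℕ→ℚ p) (ℕ→ℚ-+ r p) ⟩
      ℕ→ℚ r + ℕ→ℚ p + - ℕ→ℚ p       ≡⟨ ℚₚ.+-assoc (ℕ→ℚ r) (ℕ→ℚ p) (- ℕ→ℚ p) ⟩
      ℕ→ℚ r + (ℕ→ℚ p + - ℕ→ℚ p)     ≡⟨ cong (λ z → ℕ→ℚ r + z) (ℚₚ.+-inverseʳ (ℕ→ℚ p)) ⟩
      ℕ→ℚ r + ℚ.0ℚ                  ≡⟨ ℚₚ.+-identityʳ (ℕ→ℚ r) ⟩
      ℕ→ℚ r                         ∎
      where open ≡-Reasoning

    AQ≡α : A * Q ≡ ℕ→ℚ α
    AQ≡α = scaled-difference 4 α (sym α+p≡4q)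

    BQ≡β : B * Q ≡ ℕ→ℚ β
    BQ≡β = scaled-difference 5 β (sym β+p≡5q)

    A>0 : Positive A
    A>0 = positive-scaled A Q Q>0 α AQ≡α 1≤α

    B>0 : Positive B
    B>0 = positive-scaled B Q Q>0 β BQ≡β (ℕₚ.≤-trans 1≤α (ℕₚ.m≤m+n α q))

    integer-coefficient : ∀ c r k → c ℕ.* q ≡ r ℕ.+ p → (+ c ℤ.* + q ℤ.- +[1+ p-1 ]) ℤ.* + k ≡ + (r ℕ.* k)
    integer-coefficient c r k cq≡r+p = begin
      (+ c ℤ.* + q ℤ.- + p) ℤ.* + k     ≡⟨ cong (λ z → (z ℤ.- + p) ℤ.* + k) (sym (ℤₚ.pos-* c q)) ⟩
      (+ (c ℕ.* q) ℤ.- + p) ℤ.* + k     ≡⟨ cong (ℤ._* + k) (ℤₚ.[+m]-[+n]≡m⊖n (c ℕ.* q) p) ⟩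
      ((c ℕ.* q) ⊖ p) ℤ.* + k           ≡⟨ cong (λ z → (z ⊖ p) ℤ.* + k) cq≡r+p ⟩
      ((r ℕ.+ p) ⊖ p) ℤ.* + k           ≡⟨ cong (ℤ._* + k) (trans (ℤₚ.⊖-≥ (ℕₚ.m≤n+m p r)) (cong +_ (ℕₚ.m+n∸n≡m r p))) ⟩
      + r ℤ.* + k                       ≡⟨ sym (ℤₚ.pos-* r k) ⟩
      + (r ℕ.* k)                       ∎
      where open ≡-Reasoning

    ℕ→ℚ-scaled : ∀ {x a} → x * Q ≡ ℕ→ℚ a → ∀ i → ℕ→ℚ (a ℕ.^ i) ≡ x ^ℕ i * Q ^ℕ i
    ℕ→ℚ-scaled {x} {a} xQ≡a i = trans (ℕ→ℚ-^ a i) (trans (cong (_^ℕ i) (sym xQ≡a)) (^ℕ-distribʳ-* x Q i))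

    ℕ→ℚ-lhs : ∀ m n k → ℕ→ℚ (m ℕ.^ q ℕ.* α ℕ.^ (n ℕ.* q) ℕ.* β ℕ.^ (α ℕ.* k) ℕ.* q ℕ.^ (q ℕ.* k)) ≡
              ℕ→ℚ m ^ℕ q * (A ^ℕ (n ℕ.* q) * B ^ℕ (α ℕ.* k)) * (Q ^ℕ (n ℕ.* q) * Q ^ℕ (β ℕ.* k))
    ℕ→ℚ-lhs m n k = begin
      ℕ→ℚ (m ℕ.^ q ℕ.* α ℕ.^ nq ℕ.* β ℕ.^ αk ℕ.* q ℕ.^ qk)
        ≡⟨ trans (ℕ→ℚ-* (m ℕ.^ q ℕ.* α ℕ.^ nq ℕ.* β ℕ.^ αk) (q ℕ.^ qk)) (cong (_* ℕ→ℚ (q ℕ.^ qk))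
             (trans (ℕ→ℚ-* (m ℕ.^ q ℕ.* α ℕ.^ nq) (β ℕ.^ αk)) (cong (_* ℕ→ℚ (β ℕ.^ αk)) (ℕ→ℚ-* (m ℕ.^ q) (α ℕ.^ nq))))) ⟩
      ℕ→ℚ (m ℕ.^ q) * ℕ→ℚ (α ℕ.^ nq) * ℕ→ℚ (β ℕ.^ αk) * ℕ→ℚ (q ℕ.^ qk)
        ≡⟨ cong₂ _*_ (cong₂ _*_ (cong₂ _*_ (ℕ→ℚ-^ m q) (ℕ→ℚ-scaled AQ≡α nq)) (ℕ→ℚ-scaled BQ≡β αk)) (ℕ→ℚ-^ q qk) ⟩
      M * (A ^ℕ nq * Q ^ℕ nq) * (B ^ℕ αk * Q ^ℕ αk) * Q ^ℕ qk
        ≡⟨ reorder M (A ^ℕ nq) (B ^ℕ αk) (Q ^ℕ nq) (Q ^ℕ αk) (Q ^ℕ qk) ⟩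
      M * (A ^ℕ nq * B ^ℕ αk) * (Q ^ℕ nq * (Q ^ℕ αk * Q ^ℕ qk))
        ≡⟨ cong (λ z → M * (A ^ℕ nq * B ^ℕ αk) * (Q ^ℕ nq * z)) Q^αk*Q^qk ⟩
      M * (A ^ℕ nq * B ^ℕ αk) * (Q ^ℕ nq * Q ^ℕ βk) ∎
      where
      open ≡-Reasoning
      nq αk βk qk : ℕ
      nq = n ℕ.* q
      αk = α ℕ.* k
      βk = β ℕ.* k
      qk = q ℕ.* k
      M : ℚ
      M = ℕ→ℚ m ^ℕ q
      Q^αk*Q^qk : Q ^ℕ αk * Q ^ℕ qk ≡ Q ^ℕ βk
      Q^αk*Q^qk = trans (sym (^ℕ-+ Q αk qk)) (cong (Q ^ℕ_) (sym (ℕₚ.*-distribʳ-+ k α q)))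
      reorder : ∀ M A B Q₁ Q₂ Q₃ → M * (A * Q₁) * (B * Q₂) * Q₃ ≡ M * (A * B) * (Q₁ * (Q₂ * Q₃))
      reorder = solve 6 (λ M A B Q₁ Q₂ Q₃ → M :* (A :* Q₁) :* (B :* Q₂) :* Q₃ := M :* (A :* B) :* (Q₁ :* (Q₂ :* Q₃)))
                        refl

    ℕ→ℚ-rhs : ∀ n k → ℕ→ℚ (α ℕ.^ (β ℕ.* k) ℕ.* β ℕ.^ (n ℕ.* q)) ≡
              A ^ℕ (β ℕ.* k) * B ^ℕ (n ℕ.* q) * (Q ^ℕ (n ℕ.* q) * Q ^ℕ (β ℕ.* k))
    ℕ→ℚ-rhs n k = begin
      ℕ→ℚ (α ℕ.^ βk ℕ.* β ℕ.^ nq)                ≡⟨ ℕ→ℚ-* (α ℕ.^ βk) (β ℕ.^ nq) ⟩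
      ℕ→ℚ (α ℕ.^ βk) * ℕ→ℚ (β ℕ.^ nq)            ≡⟨ cong₂ _*_ (ℕ→ℚ-scaled AQ≡α βk) (ℕ→ℚ-scaled BQ≡β nq) ⟩
      A ^ℕ βk * Q ^ℕ βk * (B ^ℕ nq * Q ^ℕ nq)    ≡⟨ interchange (A ^ℕ βk) (Q ^ℕ βk) (B ^ℕ nq) (Q ^ℕ nq) ⟩
      A ^ℕ βk * B ^ℕ nq * (Q ^ℕ βk * Q ^ℕ nq)    ≡⟨ cong (A ^ℕ βk * B ^ℕ nq *_) (ℚₚ.*-comm (Q ^ℕ βk) (Q ^ℕ nq)) ⟩
      A ^ℕ βk * B ^ℕ nq * (Q ^ℕ nq * Q ^ℕ βk)    ∎
      where
      open ≡-Reasoning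
      nq βk : ℕ
      nq = n ℕ.* q
      βk = β ℕ.* k

    rational-form : ∀ m n k →
      m ℕ.^ q ℕ.* α ℕ.^ (n ℕ.* q) ℕ.* β ℕ.^ (α ℕ.* k) ℕ.* q ℕ.^ (q ℕ.* k) ≤ α ℕ.^ (β ℕ.* k) ℕ.* β ℕ.^ (n ℕ.* q) →
      ℕ→ℚ m ^ℕ q * (A ^ℕ (n ℕ.* q) * B ^ℕ (α ℕ.* k)) ≤ℚ A ^ℕ (β ℕ.* k) * B ^ℕ (n ℕ.* q)
    rational-form m n k h =
      ℚₚ.*-cancelʳ-≤-pos (Q ^ℕ (n ℕ.* q) * Q ^ℕ (β ℕ.* k)) {{Qᴺ>0}}
        (subst₂ _≤ℚ_ (ℕ→ℚ-lhs m n k) (ℕ→ℚ-rhs n k) (ℕ→ℚ-mono-≤ h))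
      where
      Qᴺ>0 : Positive (Q ^ℕ (n ℕ.* q) * Q ^ℕ (β ℕ.* k))
      Qᴺ>0 = ℚₚ.pos*pos⇒pos (Q ^ℕ (n ℕ.* q)) {{^ℕ-positive Q Q>0 (n ℕ.* q)}}
                            (Q ^ℕ (β ℕ.* k)) {{^ℕ-positive Q Q>0 (β ℕ.* k)}}

    mis-bound : ∀ {n} (G : Graph n) → K4Free G → ∀ k → MisBound η n k (mis k G)
    mis-bound {n} G K4 k =
      subst₂ (λ X Y → ℕ→ℚ (mis k G) ^ℕ q ≤ℚ A ^ℤ X * B ^ℤ Y) (sym X≡) (sym Y≡)
        (≤-^ℤ A B A>0 B>0 (β ℕ.* k) (n ℕ.* q) (n ℕ.* q) (α ℕ.* k)
          (rational-form (mis k G) n k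
            (IntegralForm.integral-form q p α (s≤s z≤n) 1≤α α+p≡4q n k (mis k G)
              (K4FreeBound.mis-bound G K4 α β 1≤α 6α≤5β 7β≤9α k))))
      where
      X≡ : (+ 5 ℤ.* + q ℤ.- +[1+ p-1 ]) ℤ.* + k ℤ.- + n ℤ.* + q ≡ (β ℕ.* k) ⊖ (n ℕ.* q)
      X≡ = trans (cong₂ ℤ._-_ (integer-coefficient 5 β k (sym β+p≡5q)) (sym (ℤₚ.pos-* n q)))
                 (ℤₚ.[+m]-[+n]≡m⊖n (β ℕ.* k) (n ℕ.* q))
      Y≡ : + n ℤ.* + q ℤ.- (+ 4 ℤ.* + q ℤ.- +[1+ p-1 ]) ℤ.* + k ≡ (n ℕ.* q) ⊖ (α ℕ.* k)
      Y≡ = trans (cong₂ ℤ._-_ (sym (ℤₚ.pos-* n q)) (integer-coefficient 4 α k (sym α+p≡4q)))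
                 (ℤₚ.[+m]-[+n]≡m⊖n (n ℕ.* q) (α ℕ.* k))

  ½ : ℚ
  ½ = + 1 ℚ./ 2

  0<½ : ℚ.0ℚ < ½
  0<½ = toWitness {a? = ℚ.0ℚ ℚₚ.<? ½} _

  ½<1 : ½ < ℚ.1ℚ
  ½<1 = toWitness {a? = ½ ℚₚ.<? ℚ.1ℚ} _

  mis-bound-below-½ : ∀ η → ℚ.0ℚ < η → η < ½ → ∀ {n} (G : Graph n) → K4Free G → ∀ k → MisBound η n k (mis k G)
  mis-bound-below-½ (mkℚ +[1+ p-1 ] d c) _ (ℚ.*<* (ℤ.+<+ p*2<q)) = BelowHalf.mis-bound p-1 d c p*2<q
  mis-bound-below-½ (mkℚ (+ zero)   _ _) (ℚ.*<* (ℤ.+<+ ()))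
  mis-bound-below-½ (mkℚ -[1+ _ ]   _ _) (ℚ.*<* ())

corollary1 : Σ ℚ (λ η₀ → (0ℚ < η₀) × (η₀ < 1ℚ) ×
    ((η : ℚ) → 0ℚ < η → η < η₀ →
    (n : ℕ) (G : Graph n) → K4Free G →
    (k : ℕ) → k ≤ n →
    MisBound η n k (mis k G)))
corollary1 = ½ , 0<½ , ½<1 , λ η 0<η η<½ n G K4 k _ → mis-bound-below-½ η 0<η η<½ G K4 k
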